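{- For every $n\geq1$, $$\frac{A_n(t)}{(1-t)^{n+1}}=\sum_{m\geq1}g_{\exp,n}(1^m)\,t^m\qquad\text{and}\qquad\frac{\hat A_n(t)}{(1-t)^{n+1}}=\sum_{m\geq1}g_{\tan+\sec,n}(1^m)\,t^m,$$ where $g(1^m)$ denotes the evaluation of $g(x_1,x_2,\dots)$ at $x_1=\cdots=x_m=1$, $x_{m+1}=x_{m+2}=\cdots=0$.
   Context: For a formal power series $f(x)=1+\sum_{n\geq1}a_nx^n/n!$, define the symmetric function $g_{f,n}=\sum_{\gamma\models n}\binom{n}{\gamma_1,\dots,\gamma_k}a_{\gamma_1}a_{\gamma_2}\cdots a_{\gamma_k}M_\gamma$, where $\gamma=(\gamma_1,\dots,\gamma_k)$ runs over compositions of $n$ and $M_\gamma=\sum_{i_1<\cdots<i_k}x_{i_1}^{\gamma_1}\cdots x_{i_k}^{\gamma_k}$ is the monomial quasisymmetric function. Here $\exp$ is $f(x)=e^x$ (all $a_n=1$) and $\tan+\sec$ is $f(x)=\tan x+\sec x$ (so $a_n=E_n$, the number of up-down permutations of $[n]$). $A_n(t)=\sum_{\sigma\in\mathfrak S_n}t^{d(\sigma)+1}$ is the Eulerian polynomial, $d(\sigma)$ the number of $i$ with $\sigma_i>\sigma_{i+1}$. $\hat A_n(t)=\sum_{\sigma\in\mathfrak S_n}t^{\hat d(\sigma)+1}$, where $\hat d(\sigma)$ is the number of $i\in[n-1]$ with either $i$ odd and $\sigma_i>\sigma_{i+1}$, or $i$ even and $\sigma_i<\sigma_{i+1}$. -}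

module Defs where

open import Data.Bool using (Bool; true; false; if_then_else_; _∧_; not)
open import Data.Nat as ℕ using (ℕ; zero; suc; _∸_; _<ᵇ_; _≡ᵇ_)
open import Data.Nat.Combinatorics using (_C_)
open import Data.List using (List; []; _∷_; map; filter; length; concatMap; upTo; replicate; foldr)
open import Data.Integer as ℤ using (ℤ; +_; -[1+_])
open import Relation.Nullary.Decidable using (T?)

words : ℕ → ℕ → List (List ℕ)
words n zero    = [] ∷ []
words n (suc k) = concatMap (λ i → map (suc i ∷_) (words n k)) (upTo n)

notElem : ℕ → List ℕ → Bool
notElem x []       = true
notElem x (y ∷ ys) = not (x ≡ᵇ y) ∧ notElem x ys

distinct : List ℕ → Bool
distinct []       = true
distinct (x ∷ xs) = notElem x xs ∧ distinct xs

perms : ℕ → List (List ℕ)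
perms n = filter (λ w → T? (distinct w)) (words n n)

count : {A : Set} → (A → Bool) → List A → ℕ
count p xs = length (filter (λ x → T? (p x)) xs)

b2n : Bool → ℕ
b2n true  = 1
b2n false = 0

des : List ℕ → ℕ
des (x ∷ y ∷ r) = b2n (y <ᵇ x) ℕ.+ des (y ∷ r)
des _           = 0

-- d̂(σ) : number of i ∈ [n-1] with (i odd and σᵢ > σᵢ₊₁) or (i even and σᵢ < σᵢ₊₁).
-- The Bool flag records whether the current position i is odd.
altDesAux : Bool → List ℕ → ℕ
altDesAux true  (x ∷ y ∷ r) = b2n (y <ᵇ x) ℕ.+ altDesAux false (y ∷ r)
altDesAux false (x ∷ y ∷ r) = b2n (x <ᵇ y) ℕ.+ altDesAux true  (y ∷ r)
altDesAux _     _           = 0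

altDes : List ℕ → ℕ
altDes = altDesAux true   -- positions start at i = 1 (odd)

upDownAux : Bool → List ℕ → Bool
upDownAux true  (x ∷ y ∷ r) = (x <ᵇ y) ∧ upDownAux false (y ∷ r)
upDownAux false (x ∷ y ∷ r) = (y <ᵇ x) ∧ upDownAux true  (y ∷ r)
upDownAux _     _           = true

isUpDown : List ℕ → Bool
isUpDown = upDownAux true

euler : ℕ → ℕ
euler n = count isUpDown (perms n)

Series : Set
Series = ℕ → ℤ

sumTo : ℕ → (ℕ → ℤ) → ℤ
sumTo zero    f = f 0
sumTo (suc k) f = sumTo k f ℤ.+ f (suc k)

_⊛_ : Series → Series → Series
(f ⊛ g) k = sumTo k (λ i → f i ℤ.* g (k ∸ i))

oneS : Series
oneS zero    = + 1
oneS (suc _) = + 0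

oneMinusT : Series
oneMinusT 0 = + 1
oneMinusT 1 = -[1+ 0 ]
oneMinusT _ = + 0

_^S_ : Series → ℕ → Series
f ^S zero  = oneS
f ^S suc n = f ⊛ (f ^S n)

eulerianA : ℕ → Series
eulerianA n k = + count (λ σ → (des σ ℕ.+ 1) ≡ᵇ k) (perms n)

eulerianÂ : ℕ → Series
eulerianÂ n k = + count (λ σ → (altDes σ ℕ.+ 1) ≡ᵇ k) (perms n)

-- compositions of n (lists of positive integers summing to n);
-- the first argument is fuel, fuel ≥ n suffices
compsF : ℕ → ℕ → List (List ℕ)
compsF _          zero    = [] ∷ []
compsF zero       (suc _) = []
compsF (suc fuel) (suc n) =
  concatMap (λ j → map (suc j ∷_) (compsF fuel (n ∸ j))) (upTo (suc n))

compositions : ℕ → List (List ℕ)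
compositions n = compsF n n

multinomial : ℕ → List ℕ → ℕ
multinomial n []      = 1
multinomial n (g ∷ γ) = (n C g) ℕ.* multinomial (n ∸ g) γ

-- M_γ evaluated at (x₁,…,x_m,0,0,…) where xs = x₁ ∷ ⋯ ∷ x_m ∷ []:
-- Σ_{i₁<⋯<iₖ≤m} x_{i₁}^{γ₁}⋯x_{iₖ}^{γₖ}  (split on whether i₁ = 1)
evalM : List ℕ → List ℤ → ℤ
evalM []      _        = + 1
evalM (g ∷ γ) []       = + 0
evalM (g ∷ γ) (x ∷ xs) = (x ℤ.^ g) ℤ.* evalM γ xs ℤ.+ evalM (g ∷ γ) xs

productℤ : List ℕ → ℤ
productℤ = foldr (λ a r → + a ℤ.* r) (+ 1)

-- g_{f,n} evaluated at xs, where a n is the coefficient a_n of f = 1 + Σ aₙ xⁿ/n!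
evalG : (ℕ → ℕ) → ℕ → List ℤ → ℤ
evalG a n xs = foldr ℤ._+_ (+ 0)
  (map (λ γ → + multinomial n γ ℤ.* productℤ (map a γ) ℤ.* evalM γ xs)
       (compositions n))

ones : ℕ → List ℤ
ones m = replicate m (+ 1)

gSeries : (ℕ → ℕ) → ℕ → Series
gSeries a n zero    = + 0
gSeries a n (suc m) = evalG a n (ones (suc m))

-- exp : aₙ = 1 ;  tan + sec : aₙ = Eₙ
aExp : ℕ → ℕ
aExp _ = 1

aTanSec : ℕ → ℕ
aTanSec = euler

module Submission where

-- Both are instances of one
-- generalised Worpitzky identity, proved for any "descent rule" (which adjacent pairs
-- count as descents, possibly depending on the parity of the position):
--  * g_{f,n}(1^m) obeys the recursion got by setting x₁ = 1, which splits off a block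
--    of g letters in C(n,g)·a_g ways (gOnes, QuasisymmetricAtOnes).
--  * C(m+n-1-des σ, n) counts the labellings of σ by 1,…,m that weakly increase and
--    strictly increase at descents; the block labelled 1 gives a Pascal-type recursion
--    in m (Labellings).  Summed over all orderings of [n] this is gOnes, as soon as the
--    descent-free g-arrangements of an n-set number C(n,g)·a_g (Worpitzky); that count
--    reduces by double counting to the orderings of [1..g] (DescentFreeArrangements),
--    which number 1 = a_g for ordinary descents and E_g = a_g for alternating ones.
--  * Σ_σ C(j+n-1-des σ, n) is the t^j-coefficient of A_n(t)/(1-t)^{n+1}; clearing the
--    denominator is iterated differencing (PowerSeries, Assembly).

module Sums where

  open import Data.Bool using (Bool; true; false; _∧_)
  open import Data.Nat
  open import Data.Nat.Properties
  open import Data.List using (List; []; _∷_; _++_; map; concatMap; concat; length; filterᵇ; upTo)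
  open import Data.List.Properties using (map-upTo)
  open import Data.List.Relation.Unary.All using (All; []; _∷_; universal)
  open import Relation.Binary.PropositionalEquality
  open import Function using (_∘_)
  open import Algebra.Properties.CommutativeSemigroup +-commutativeSemigroup
    using (interchange)
  open import Defs using (b2n; count)

  ΣL : {A : Set} → (A → ℕ) → List A → ℕ
  ΣL f []       = 0
  ΣL f (x ∷ xs) = f x + ΣL f xs

  syntax ΣL (λ x → e) xs = ∑[ x ← xs ] e

  module _ {A : Set} where

    ΣL-++ : (f : A → ℕ) (xs ys : List A) → ΣL f (xs ++ ys) ≡ ΣL f xs + ΣL f ys
    ΣL-++ f []       ys = refl
    ΣL-++ f (x ∷ xs) ys = trans (cong (f x +_) (ΣL-++ f xs ys)) (sym (+-assoc (f x) _ _))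

    ΣL-cong : {f g : A → ℕ} {xs : List A} → All (λ x → f x ≡ g x) xs → ΣL f xs ≡ ΣL g xs
    ΣL-cong []       = refl
    ΣL-cong (e ∷ es) = cong₂ _+_ e (ΣL-cong es)

    ΣL-ext : {f g : A → ℕ} → (∀ x → f x ≡ g x) → (xs : List A) → ΣL f xs ≡ ΣL g xs
    ΣL-ext e []       = refl
    ΣL-ext e (x ∷ xs) = cong₂ _+_ (e x) (ΣL-ext e xs)

    ΣL-+ : (f g : A → ℕ) (xs : List A) → ∑[ x ← xs ] (f x + g x) ≡ ΣL f xs + ΣL g xs
    ΣL-+ f g []       = refl
    ΣL-+ f g (x ∷ xs) =
      trans (cong (f x + g x +_) (ΣL-+ f g xs)) (interchange (f x) (g x) (ΣL f xs) (ΣL g xs))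

    ΣL-*ˡ : (c : ℕ) (f : A → ℕ) (xs : List A) → ∑[ x ← xs ] (c * f x) ≡ c * ΣL f xs
    ΣL-*ˡ c f []       = sym (*-zeroʳ c)
    ΣL-*ˡ c f (x ∷ xs) =
      trans (cong (c * f x +_) (ΣL-*ˡ c f xs)) (sym (*-distribˡ-+ c (f x) (ΣL f xs)))

    ΣL-*ʳ : (c : ℕ) (f : A → ℕ) (xs : List A) → ∑[ x ← xs ] (f x * c) ≡ ΣL f xs * c
    ΣL-*ʳ c f xs =
      trans (ΣL-ext (λ x → *-comm (f x) c) xs) (trans (ΣL-*ˡ c f xs) (*-comm c (ΣL f xs)))

    ΣL-const : (c : ℕ) (xs : List A) → ∑[ x ← xs ] c ≡ length xs * c
    ΣL-const c []       = refl
    ΣL-const c (x ∷ xs) = cong (c +_) (ΣL-const c xs)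

    ΣL-zero-on : {f : A → ℕ} {xs : List A} → All (λ x → f x ≡ 0) xs → ΣL f xs ≡ 0
    ΣL-zero-on []       = refl
    ΣL-zero-on (e ∷ es) = cong₂ _+_ e (ΣL-zero-on es)

    ΣL-zero : {f : A → ℕ} → (∀ x → f x ≡ 0) → (xs : List A) → ΣL f xs ≡ 0
    ΣL-zero e xs = ΣL-zero-on (universal e xs)

    ΣL-filterᵇ : (p : A → Bool) (f : A → ℕ) (xs : List A) →
                 ΣL f (filterᵇ p xs) ≡ ∑[ x ← xs ] (b2n (p x) * f x)
    ΣL-filterᵇ p f []       = refl
    ΣL-filterᵇ p f (x ∷ xs) with p x
    ... | true  = cong₂ _+_ (sym (+-identityʳ (f x))) (ΣL-filterᵇ p f xs)
    ... | false = ΣL-filterᵇ p f xs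

    count-as-sum : (p : A → Bool) (xs : List A) → count p xs ≡ ∑[ x ← xs ] b2n (p x)
    count-as-sum p []       = refl
    count-as-sum p (x ∷ xs) with p x
    ... | true  = cong suc (count-as-sum p xs)
    ... | false = count-as-sum p xs

  module _ {A B : Set} where

    ΣL-map : (f : B → ℕ) (g : A → B) (xs : List A) → ΣL f (map g xs) ≡ ΣL (f ∘ g) xs
    ΣL-map f g []       = refl
    ΣL-map f g (x ∷ xs) = cong (f (g x) +_) (ΣL-map f g xs)

    ΣL-concatMap : (f : B → ℕ) (g : A → List B) (xs : List A) →
                   ΣL f (concatMap g xs) ≡ ∑[ x ← xs ] ΣL f (g x)
    ΣL-concatMap f g []       = refl
    ΣL-concatMap f g (x ∷ xs) =
      trans (ΣL-++ f (g x) (concat (map g xs))) (cong (ΣL f (g x) +_) (ΣL-concatMap f g xs))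

    ΣL-swap : (F : A → B → ℕ) (xs : List A) (ys : List B) →
              ∑[ x ← xs ] ∑[ y ← ys ] F x y ≡ ∑[ y ← ys ] ∑[ x ← xs ] F x y
    ΣL-swap F []       ys = sym (ΣL-zero (λ _ → refl) ys)
    ΣL-swap F (x ∷ xs) ys =
      trans (cong (ΣL (F x) ys +_) (ΣL-swap F xs ys))
            (sym (ΣL-+ (F x) (λ y → ∑[ x′ ← xs ] F x′ y) ys))

  split-indicator : ∀ a b n → b2n (a ∧ b) * n ≡ b2n a * (b2n b * n)
  split-indicator true  b n = sym (+-identityʳ (b2n b * n))
  split-indicator false b n = refl

  ΣL-upTo-suc : (f : ℕ → ℕ) (n : ℕ) → ΣL f (upTo (suc n)) ≡ f 0 + ∑[ g ← upTo n ] f (suc g)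
  ΣL-upTo-suc f n = cong (f 0 +_) (trans (cong (ΣL f) (sym (map-upTo suc n))) (ΣL-map f suc (upTo n)))

module FallingFactorial where

  open import Data.Nat
  open import Data.Nat.Properties
  open import Data.Nat.Combinatorics using (_C_; nCk≡n!/k![n-k]!; k![n∸k]!∣n!)
  open import Data.Nat.DivMod using (m/n*n≡m)
  open import Relation.Binary.PropositionalEquality

  fall : ℕ → ℕ → ℕ
  fall n zero    = 1
  fall n (suc k) = n * fall (n ∸ 1) k

  fall-! : ∀ n → fall n n ≡ n !
  fall-! zero    = refl
  fall-! (suc n) = cong (suc n *_) (fall-! n)

  fall-* : ∀ n j → j ≤ n → fall n j * (n ∸ j) ! ≡ n !
  fall-* n       zero    _         = *-identityˡ (n !)
  fall-* (suc n) (suc j) (s≤s j≤n) = trans (*-assoc (suc n) (fall n j) _) (cong (suc n *_) (fall-* n j j≤n))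

  binomial-fall : ∀ n k → k ≤ n → (n C k) * (n ∸ k) ! ≡ fall n (n ∸ k)
  binomial-fall n k k≤n = *-cancelʳ-≡ _ _ (k !) {{k !≢0}} (trans C-side (sym fall-side))
    where
    instance
      _ = k !≢0
      _ = (n ∸ k) !≢0
      _ = m*n≢0 (k !) ((n ∸ k) !)
    C-side : (n C k) * (n ∸ k) ! * k ! ≡ n !
    C-side = begin
        (n C k) * (n ∸ k) ! * k !     ≡⟨ *-assoc (n C k) _ _ ⟩
        (n C k) * ((n ∸ k) ! * k !)   ≡⟨ cong ((n C k) *_) (*-comm ((n ∸ k) !) (k !)) ⟩
        (n C k) * (k ! * (n ∸ k) !)   ≡⟨ cong (_* (k ! * (n ∸ k) !)) (nCk≡n!/k![n-k]! k≤n) ⟩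
        n ! / (k ! * (n ∸ k) !) * (k ! * (n ∸ k) !) ≡⟨ m/n*n≡m (k![n∸k]!∣n! k≤n) ⟩
        n ! ∎
      where open ≡-Reasoning
    fall-side : fall n (n ∸ k) * k ! ≡ n !
    fall-side = trans (cong (λ j → fall n (n ∸ k) * j !) (sym (m∸[m∸n]≡n k≤n))) (fall-* n (n ∸ k) (m∸n≤m n k))

module Arrangements where

  open import Data.Nat
  open import Data.Nat.Properties
  open import Data.List using (List; []; _∷_; _++_; map; concatMap; length)
  open import Data.List.Properties using (length-map)
  open import Data.List.Relation.Unary.All as All using (All; []; _∷_)
  open import Data.List.Relation.Unary.All.Properties using (map⁺; concat⁺)
  open import Data.List.Relation.Unary.Any using (Any; here; there)
  open import Data.List.Relation.Unary.AllPairs using (AllPairs; []; _∷_)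
  open import Data.List.Relation.Binary.Permutation.Propositional
    using (_↭_; refl; prep; swap; trans)
  open import Data.Product using (_×_; _,_)
  open import Data.Sum using (_⊎_; inj₁; inj₂; [_,_])
  open import Relation.Binary.PropositionalEquality as Eq
    using (_≡_; cong; cong₂; sym; module ≡-Reasoning)
  open import Function using (_∘_)
  open import Algebra.Properties.CommutativeSemigroup +-commutativeSemigroup
    using (x∙yz≈y∙xz)
  open Sums
  open FallingFactorial using (fall)

  record Choice (X : Set) : Set where
    constructor choice
    field
      chosen : X
      others : List X

  record Arrangement (X : Set) : Set where
    constructor arrangement
    field
      word : List X
      rest : List X

  open Choice public
  open Arrangement public

  module _ {X : Set} where

    choices : List X → List (Choice X)
    choices []       = []
    choices (x ∷ xs) = choice x xs ∷ map (λ c → choice (chosen c) (x ∷ others c)) (choices xs)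

    extend : Choice X → Arrangement X → Arrangement X
    extend c α = arrangement (chosen c ∷ word α) (rest α)

    arrangements : List X → ℕ → List (Arrangement X)
    arrangements S zero    = arrangement [] S ∷ []
    arrangements S (suc k) =
      concatMap (λ c → map (extend c) (arrangements (others c) k)) (choices S)

    sum-choices-∷ : (f : Choice X → ℕ) (x : X) (xs : List X) →
      ΣL f (choices (x ∷ xs)) ≡ f (choice x xs) + ∑[ c ← choices xs ] f (choice (chosen c) (x ∷ others c))
    sum-choices-∷ f x xs = cong (f (choice x xs) +_) (ΣL-map f _ (choices xs))

    sum-arrangements-suc : (f : Arrangement X → ℕ) (S : List X) (k : ℕ) →
      ΣL f (arrangements S (suc k)) ≡ ∑[ c ← choices S ] ∑[ α ← arrangements (others c) k ] f (extend c α)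
    sum-arrangements-suc f S k =
      Eq.trans (ΣL-concatMap f _ (choices S))
               (ΣL-ext (λ c → ΣL-map f (extend c) (arrangements (others c) k)) (choices S))

    sum-arrangements-+ : (g l : ℕ) (f : Arrangement X → ℕ) (S : List X) →
      ΣL f (arrangements S (g + l))
        ≡ ∑[ α ← arrangements S g ] ∑[ β ← arrangements (rest α) l ] f (arrangement (word α ++ word β) (rest β))
    sum-arrangements-+ zero    l f S = sym (+-identityʳ _)
    sum-arrangements-+ (suc g) l f S =
      Eq.trans (sum-arrangements-suc f S (g + l))
        (Eq.trans (ΣL-ext (λ c → sum-arrangements-+ g l (f ∘ extend c) (others c)) (choices S))
                  (sym (sum-arrangements-suc _ S g)))

    choices-swap : (K : X → X → List X → ℕ) (S : List X) →
      ∑[ c ← choices S ] ∑[ d ← choices (others c) ] K (chosen c) (chosen d) (others d)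
        ≡ ∑[ c ← choices S ] ∑[ d ← choices (others c) ] K (chosen d) (chosen c) (others d)
    choices-swap K []      = Eq.refl
    choices-swap K (z ∷ S) = begin
        ∑[ c ← choices (z ∷ S) ] ∑[ d ← choices (others c) ] K (chosen c) (chosen d) (others d)
          ≡⟨ sum-choices-∷ (λ c → ∑[ d ← choices (others c) ] K (chosen c) (chosen d) (others d)) z S ⟩
        A + ∑[ c ← choices S ] ∑[ d ← choices (z ∷ others c) ] K (chosen c) (chosen d) (others d)
          ≡⟨ cong (A +_) (Eq.trans (ΣL-ext (λ c → sum-choices-∷ (λ d → K (chosen c) (chosen d) (others d)) z (others c)) (choices S))
                                   (ΣL-+ _ _ (choices S))) ⟩
        A + (B + R)
          ≡⟨ cong (λ r → A + (B + r)) (choices-swap (λ x y t → K x y (z ∷ t)) S) ⟩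
        A + (B + R′)
          ≡⟨ x∙yz≈y∙xz A B R′ ⟩
        B + (A + R′)
          ≡⟨ cong (B +_) (Eq.trans (sym (ΣL-+ _ _ (choices S)))
                                   (ΣL-ext (λ c → sym (sum-choices-∷ (λ d → K (chosen d) (chosen c) (others d)) z (others c))) (choices S))) ⟩
        B + ∑[ c ← choices S ] ∑[ d ← choices (z ∷ others c) ] K (chosen d) (chosen c) (others d)
          ≡⟨ sym (sum-choices-∷ (λ c → ∑[ d ← choices (others c) ] K (chosen d) (chosen c) (others d)) z S) ⟩
        ∑[ c ← choices (z ∷ S) ] ∑[ d ← choices (others c) ] K (chosen d) (chosen c) (others d) ∎
      where
      open ≡-Reasoning
      A  = ∑[ d ← choices S ] K z (chosen d) (others d)
      B  = ∑[ c ← choices S ] K (chosen c) z (others c)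
      R  = ∑[ c ← choices S ] ∑[ d ← choices (others c) ] K (chosen c) (chosen d) (z ∷ others d)
      R′ = ∑[ c ← choices S ] ∑[ d ← choices (others c) ] K (chosen d) (chosen c) (z ∷ others d)

    choices-arrangements-swap : (b : ℕ) (H : X → List X → List X → ℕ) (S : List X) →
      ∑[ c ← choices S ] ∑[ β ← arrangements (others c) b ] H (chosen c) (word β) (rest β)
        ≡ ∑[ β ← arrangements S b ] ∑[ c ← choices (rest β) ] H (chosen c) (word β) (others c)
    choices-arrangements-swap zero    H S =
      Eq.trans (ΣL-ext (λ c → +-identityʳ _) (choices S)) (sym (+-identityʳ _))
    choices-arrangements-swap (suc b) H S = begin
        ∑[ c ← choices S ] ∑[ β ← arrangements (others c) (suc b) ] H (chosen c) (word β) (rest β)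
          ≡⟨ ΣL-ext (λ c → sum-arrangements-suc (λ β → H (chosen c) (word β) (rest β)) (others c) b) (choices S) ⟩
        ∑[ c ← choices S ] ∑[ d ← choices (others c) ] ∑[ β ← arrangements (others d) b ] H (chosen c) (chosen d ∷ word β) (rest β)
          ≡⟨ choices-swap (λ x y t → ∑[ β ← arrangements t b ] H x (y ∷ word β) (rest β)) S ⟩
        ∑[ c ← choices S ] ∑[ d ← choices (others c) ] ∑[ β ← arrangements (others d) b ] H (chosen d) (chosen c ∷ word β) (rest β)
          ≡⟨ ΣL-ext (λ c → choices-arrangements-swap b (λ x w t → H x (chosen c ∷ w) t) (others c)) (choices S) ⟩
        ∑[ c ← choices S ] ∑[ β ← arrangements (others c) b ] ∑[ d ← choices (rest β) ] H (chosen d) (chosen c ∷ word β) (others d)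
          ≡⟨ sym (sum-arrangements-suc (λ β → ∑[ d ← choices (rest β) ] H (chosen d) (word β) (others d)) S b) ⟩
        ∑[ β ← arrangements S (suc b) ] ∑[ c ← choices (rest β) ] H (chosen c) (word β) (others c) ∎
      where open ≡-Reasoning

    arrangements-swap : (a b : ℕ) (G : List X → List X → List X → ℕ) (S : List X) →
      ∑[ α ← arrangements S a ] ∑[ β ← arrangements (rest α) b ] G (word α) (word β) (rest β)
        ≡ ∑[ β ← arrangements S b ] ∑[ α ← arrangements (rest β) a ] G (word α) (word β) (rest α)
    arrangements-swap zero    b G S =
      Eq.trans (+-identityʳ _) (ΣL-ext (λ β → sym (+-identityʳ _)) (arrangements S b))
    arrangements-swap (suc a) b G S = begin
        ∑[ α ← arrangements S (suc a) ] ∑[ β ← arrangements (rest α) b ] G (word α) (word β) (rest β)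
          ≡⟨ sum-arrangements-suc _ S a ⟩
        ∑[ c ← choices S ] ∑[ α ← arrangements (others c) a ] ∑[ β ← arrangements (rest α) b ] G (chosen c ∷ word α) (word β) (rest β)
          ≡⟨ ΣL-ext (λ c → arrangements-swap a b (λ u v t → G (chosen c ∷ u) v t) (others c)) (choices S) ⟩
        ∑[ c ← choices S ] ∑[ β ← arrangements (others c) b ] ∑[ α ← arrangements (rest β) a ] G (chosen c ∷ word α) (word β) (rest α)
          ≡⟨ choices-arrangements-swap b (λ x v t → ∑[ α ← arrangements t a ] G (x ∷ word α) v (rest α)) S ⟩
        ∑[ β ← arrangements S b ] ∑[ c ← choices (rest β) ] ∑[ α ← arrangements (others c) a ] G (chosen c ∷ word α) (word β) (rest α)
          ≡⟨ ΣL-ext (λ β → sym (sum-arrangements-suc (λ α → G (word α) (word β) (rest α)) (rest β) a)) (arrangements S b) ⟩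
        ∑[ β ← arrangements S b ] ∑[ α ← arrangements (rest β) (suc a) ] G (word α) (word β) (rest α) ∎
      where open ≡-Reasoning

    choices-All : {Q : X → Set} (S : List X) → All Q S →
                  All (λ c → Q (chosen c) × All Q (others c)) (choices S)
    choices-All []       []         = []
    choices-All (x ∷ xs) (qx ∷ qxs) =
      (qx , qxs) ∷ map⁺ (All.map (λ (qc , qo) → qc , qx ∷ qo) (choices-All xs qxs))

    arrangements-All : {Q : X → Set} (k : ℕ) (S : List X) → All Q S →
                       All (λ α → All Q (word α) × All Q (rest α)) (arrangements S k)
    arrangements-All zero    S qs = ([] , qs) ∷ []
    arrangements-All (suc k) S qs = concat⁺ (map⁺ (All.map
      (λ {c} (qc , qo) → map⁺ (All.map (λ (qw , qr) → qc ∷ qw , qr) (arrangements-All k (others c) qo)))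
      (choices-All S qs)))

    choices-length : (S : List X) → All (λ c → suc (length (others c)) ≡ length S) (choices S)
    choices-length []       = []
    choices-length (x ∷ xs) = Eq.refl ∷ map⁺ (All.map (cong suc) (choices-length xs))

    arrangements-length : (k : ℕ) (S : List X) →
      All (λ α → length (word α) ≡ k × length (rest α) + k ≡ length S) (arrangements S k)
    arrangements-length zero    S = (Eq.refl , +-identityʳ _) ∷ []
    arrangements-length (suc k) S = concat⁺ (map⁺ (All.map
      (λ {c} e → map⁺ (All.map (λ {β} (ew , er) →
                   cong suc ew , Eq.trans (+-suc (length (rest β)) k) (Eq.trans (cong suc er) e))
                 (arrangements-length k (others c))))
      (choices-length S)))

    rest-length : (k : ℕ) (S : List X) (α : Arrangement X) →
                  length (rest α) + k ≡ length S → length (rest α) ≡ length S ∸ k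
    rest-length k S α e = Eq.trans (sym (m+n∸n≡m (length (rest α)) k)) (cong (_∸ k) e)

    choices-AllPairs : {R : X → X → Set} (S : List X) → AllPairs R S →
                       All (λ c → AllPairs R (others c)) (choices S)
    choices-AllPairs []       []         = []
    choices-AllPairs (x ∷ xs) (rx ∷ rxs) = rxs ∷ map⁺ (All.zipWith (λ (ro , (_ , rxo)) → rxo ∷ ro)
                                             (choices-AllPairs xs rxs , choices-All xs rx))

    rest-AllPairs : {R : X → X → Set} (k : ℕ) (S : List X) → AllPairs R S →
                    All (λ α → AllPairs R (rest α)) (arrangements S k)
    rest-AllPairs zero    S rs = rs ∷ []
    rest-AllPairs (suc k) S rs = concat⁺ (map⁺ (All.map
      (λ {c} ro → map⁺ (rest-AllPairs k (others c) ro)) (choices-AllPairs S rs)))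

    module _ {R : X → X → Set} (R-sym : ∀ {x y} → R x y → R y x) where

      choices-AllPairs-sym : (S : List X) → AllPairs R S →
        All (λ c → All (R (chosen c)) (others c) × AllPairs R (others c)) (choices S)
      choices-AllPairs-sym []       []         = []
      choices-AllPairs-sym (x ∷ xs) (rx ∷ rxs) = (rx , rxs) ∷ map⁺ (All.zipWith
        (λ ((rco , ro) , (rxc , rxo)) → R-sym rxc ∷ rco , rxo ∷ ro)
        (choices-AllPairs-sym xs rxs , choices-All xs rx))

      word-AllPairs : (k : ℕ) (S : List X) → AllPairs R S →
                      All (λ α → AllPairs R (word α) × AllPairs R (rest α)) (arrangements S k)
      word-AllPairs zero    S rs = ([] , rs) ∷ []
      word-AllPairs (suc k) S rs = concat⁺ (map⁺ (All.map
        (λ {c} (rco , ro) → map⁺ (All.zipWith (λ ((rw , rr) , (rcw , _)) → rcw ∷ rw , rr)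
                                   (word-AllPairs k (others c) ro , arrangements-All k (others c) rco)))
        (choices-AllPairs-sym S rs)))

    choices-Any : {Q : X → Set} (S : List X) → Any Q S →
                  All (λ c → Q (chosen c) ⊎ Any Q (others c)) (choices S)
    choices-Any (x ∷ xs) (here q)  = inj₁ q ∷ map⁺ (All.universal (λ _ → inj₂ (here q)) (choices xs))
    choices-Any (x ∷ xs) (there a) = inj₂ a ∷ map⁺ (All.map [ inj₁ , inj₂ ∘ there ] (choices-Any xs a))

    full-arrangements-Any : {Q : X → Set} (k : ℕ) (S : List X) → length S ≡ k → Any Q S →
                            All (λ α → Any Q (word α)) (arrangements S k)
    full-arrangements-Any zero    [] _ ()
    full-arrangements-Any (suc k) S eS a = concat⁺ (map⁺ (All.zipWith
      (λ {c} (qc , ec) → map⁺ (first-or-later c qc ec)) (choices-Any S a , choices-length S)))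
      where
      first-or-later : ∀ c → _ → suc (length (others c)) ≡ length S →
                       All (λ β → Any _ (word (extend c β))) (arrangements (others c) k)
      first-or-later c (inj₁ q) ec = All.universal (λ _ → here q) _
      first-or-later c (inj₂ a) ec =
        All.map there (full-arrangements-Any k (others c) (suc-injective (Eq.trans ec eS)) a)

    choices-count : (S : List X) → length (choices S) ≡ length S
    choices-count []       = Eq.refl
    choices-count (x ∷ xs) = cong suc (Eq.trans (length-map _ (choices xs)) (choices-count xs))

    arrangements-count : (k : ℕ) (S : List X) → length (arrangements S k) ≡ fall (length S) k
    arrangements-count zero    S = Eq.refl
    arrangements-count (suc k) S = begin
        length (arrangements S (suc k))
          ≡⟨ length-as-sum (arrangements S (suc k)) ⟩
        ∑[ α ← arrangements S (suc k) ] 1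
          ≡⟨ sum-arrangements-suc (λ _ → 1) S k ⟩
        ∑[ c ← choices S ] ∑[ β ← arrangements (others c) k ] 1
          ≡⟨ ΣL-cong (All.map (λ {c} e → Eq.trans (sym (length-as-sum (arrangements (others c) k)))
                                           (Eq.trans (arrangements-count k (others c))
                                                     (cong (λ n → fall n k) (others-length c e))))
                              (choices-length S)) ⟩
        ∑[ c ← choices S ] fall (length S ∸ 1) k
          ≡⟨ ΣL-const _ (choices S) ⟩
        length (choices S) * fall (length S ∸ 1) k
          ≡⟨ cong (_* fall (length S ∸ 1) k) (choices-count S) ⟩
        fall (length S) (suc k) ∎
      where
      open ≡-Reasoning
      length-as-sum : {A : Set} (xs : List A) → length xs ≡ ∑[ x ← xs ] 1
      length-as-sum xs = sym (Eq.trans (ΣL-const 1 xs) (*-identityʳ (length xs)))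
      others-length : ∀ c → suc (length (others c)) ≡ length S → length (others c) ≡ length S ∸ 1
      others-length c e = cong (_∸ 1) e

  module _ {X Y : Set} (f : X → Y) where

    choices-map : (G : Choice Y → ℕ) (S : List X) →
      ΣL G (choices (map f S)) ≡ ∑[ c ← choices S ] G (choice (f (chosen c)) (map f (others c)))
    choices-map G []       = Eq.refl
    choices-map G (x ∷ xs) = Eq.trans (sum-choices-∷ G (f x) (map f xs))
      (Eq.trans (cong (G (choice (f x) (map f xs)) +_) (choices-map (λ c → G (choice (chosen c) (f x ∷ others c))) xs))
                (sym (sum-choices-∷ (λ c → G (choice (f (chosen c)) (map f (others c)))) x xs)))

    arrangements-map : (k : ℕ) (F : Arrangement Y → ℕ) (S : List X) →
      ΣL F (arrangements (map f S) k) ≡ ∑[ α ← arrangements S k ] F (arrangement (map f (word α)) (map f (rest α)))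
    arrangements-map zero    F S = Eq.refl
    arrangements-map (suc k) F S = Eq.trans (sum-arrangements-suc F (map f S) k)
      (Eq.trans (choices-map (λ c → ∑[ β ← arrangements (others c) k ] F (extend c β)) S)
        (Eq.trans (ΣL-ext (λ c → arrangements-map k (F ∘ extend (choice (f (chosen c)) [])) (others c)) (choices S))
                  (sym (sum-arrangements-suc _ S k))))

  module _ {X : Set} where

    choices-↭ : (G : X → List X → ℕ) → (∀ x {r r′} → r ↭ r′ → G x r ≡ G x r′) →
                {S S′ : List X} → S ↭ S′ →
                ∑[ c ← choices S ] G (chosen c) (others c) ≡ ∑[ c ← choices S′ ] G (chosen c) (others c)
    choices-↭ G G-resp refl = Eq.refl
    choices-↭ G G-resp (prep {xs} {ys} x p) = Eq.trans (sum-choices-∷ _ x xs)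
      (Eq.trans (cong₂ _+_ (G-resp x p) (choices-↭ (λ y r → G y (x ∷ r)) (λ y e → G-resp y (prep x e)) p))
                (sym (sum-choices-∷ _ x ys)))
    choices-↭ G G-resp (swap {xs} {ys} x y p) = begin
        ∑[ c ← choices (x ∷ y ∷ xs) ] G (chosen c) (others c)
          ≡⟨ Eq.trans (sum-choices-∷ H x (y ∷ xs)) (cong (G x (y ∷ xs) +_) (sum-choices-∷ (H ∘ push x) y xs)) ⟩
        G x (y ∷ xs) + (G y (x ∷ xs) + ∑[ c ← choices xs ] G (chosen c) (x ∷ y ∷ others c))
          ≡⟨ cong₂ (λ u v → u + (v + R)) (G-resp x (prep y p)) (G-resp y (prep x p)) ⟩
        G x (y ∷ ys) + (G y (x ∷ ys) + ∑[ c ← choices xs ] G (chosen c) (x ∷ y ∷ others c))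
          ≡⟨ cong (λ z → G x (y ∷ ys) + (G y (x ∷ ys) + z))
               (Eq.trans (choices-↭ (λ z r → G z (x ∷ y ∷ r)) (λ z e → G-resp z (prep x (prep y e))) p)
                         (ΣL-ext (λ c → G-resp (chosen c) (swap x y refl)) (choices ys))) ⟩
        G x (y ∷ ys) + (G y (x ∷ ys) + ∑[ c ← choices ys ] G (chosen c) (y ∷ x ∷ others c))
          ≡⟨ x∙yz≈y∙xz (G x (y ∷ ys)) (G y (x ∷ ys)) R′ ⟩
        G y (x ∷ ys) + (G x (y ∷ ys) + ∑[ c ← choices ys ] G (chosen c) (y ∷ x ∷ others c))
          ≡⟨ sym (Eq.trans (sum-choices-∷ H y (x ∷ ys)) (cong (G y (x ∷ ys) +_) (sum-choices-∷ (H ∘ push y) x ys))) ⟩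
        ∑[ c ← choices (y ∷ x ∷ ys) ] G (chosen c) (others c) ∎
      where
      open ≡-Reasoning
      H : Choice X → ℕ
      H c = G (chosen c) (others c)
      push : X → Choice X → Choice X
      push z c = choice (chosen c) (z ∷ others c)
      R  = ∑[ c ← choices xs ] G (chosen c) (x ∷ y ∷ others c)
      R′ = ∑[ c ← choices ys ] G (chosen c) (y ∷ x ∷ others c)
    choices-↭ G G-resp (trans p q) = Eq.trans (choices-↭ G G-resp p) (choices-↭ G G-resp q)

    arrangements-↭ : (k : ℕ) (f : List X → ℕ) {S S′ : List X} → S ↭ S′ →
      ∑[ α ← arrangements S k ] f (word α) ≡ ∑[ α ← arrangements S′ k ] f (word α)
    arrangements-↭ zero    f p = Eq.refl
    arrangements-↭ (suc k) f {S} {S′} p = Eq.trans (sum-arrangements-suc (f ∘ word) S k)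
      (Eq.trans (choices-↭ (λ x r → ∑[ β ← arrangements r k ] f (x ∷ word β)) (λ x e → arrangements-↭ k (f ∘ (x ∷_)) e) p)
                (sym (sum-arrangements-suc (f ∘ word) S′ k)))

module BooleanComparisons where

  open import Data.Bool using (true; false; T)
  open import Data.Empty using (⊥-elim)
  open import Data.Unit using (tt)
  open import Data.Nat
  open import Data.Nat.Properties using (≡ᵇ⇒≡; ≡⇒≡ᵇ; <⇒<ᵇ; <ᵇ⇒<; <-asym)
  open import Relation.Nullary using (¬_)
  open import Relation.Binary.PropositionalEquality
  open import Function using (_∘_)

  T⇒≡true : ∀ {b} → T b → b ≡ true
  T⇒≡true {true} _ = refl

  ¬T⇒≡false : ∀ {b} → ¬ T b → b ≡ false
  ¬T⇒≡false {true}  ¬t = ⊥-elim (¬t tt)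
  ¬T⇒≡false {false} _  = refl

  ≡ᵇ-refl : ∀ x → (x ≡ᵇ x) ≡ true
  ≡ᵇ-refl x = T⇒≡true (≡⇒≡ᵇ x x refl)

  ≢⇒≡ᵇ-false : ∀ {x y} → x ≢ y → (x ≡ᵇ y) ≡ false
  ≢⇒≡ᵇ-false {x} {y} x≢y = ¬T⇒≡false (x≢y ∘ ≡ᵇ⇒≡ x y)

  <⇒<ᵇ-true : ∀ {x y} → x < y → (x <ᵇ y) ≡ true
  <⇒<ᵇ-true x<y = T⇒≡true (<⇒<ᵇ x<y)

  <⇒>ᵇ-false : ∀ {x y} → x < y → (y <ᵇ x) ≡ false
  <⇒>ᵇ-false {x} {y} x<y = ¬T⇒≡false (<-asym x<y ∘ <ᵇ⇒< y x)

module Permutations where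

  open import Data.Bool using (T; not; _∧_)
  open import Data.Nat
  open import Data.Nat.Properties
  open import Data.List using (List; []; _∷_; map; concatMap; upTo; applyUpTo; length; filterᵇ)
  open import Data.List.Properties using (concatMap-map; map-upTo; length-applyUpTo; filter-accept; filter-all)
  open import Data.List.Relation.Unary.All as All using (All; []; _∷_)
  open import Data.List.Relation.Unary.All.Properties using (applyUpTo⁺₁)
  open import Data.List.Relation.Unary.AllPairs as AllPairs using (AllPairs; []; _∷_)
  import Data.List.Relation.Unary.AllPairs.Properties as AllPairsₚ
  open import Relation.Nullary.Decidable using (T?)
  open import Relation.Binary.PropositionalEquality
  open import Function using (_∘_)
  open import Defs using (words; notElem; distinct; perms; b2n)
  open Sums
  open Arrangements
  open BooleanComparisons

  range : ℕ → List ℕ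
  range n = applyUpTo suc n

  range-length : ∀ n → length (range n) ≡ n
  range-length n = length-applyUpTo suc n

  range-increasing : ∀ n → AllPairs _<_ (range n)
  range-increasing n = AllPairsₚ.applyUpTo⁺₁ suc n (λ i<j _ → s<s i<j)

  range-distinct : ∀ n → AllPairs _≢_ (range n)
  range-distinct n = AllPairs.map <⇒≢ (range-increasing n)

  range-bounded : ∀ n → All (_≤ n) (range n)
  range-bounded n = applyUpTo⁺₁ suc n (λ i<n → i<n)

  wordsOver : List ℕ → ℕ → List (List ℕ)
  wordsOver A zero    = [] ∷ []
  wordsOver A (suc k) = concatMap (λ x → map (x ∷_) (wordsOver A k)) A

  words-as-wordsOver : ∀ n k → words n k ≡ wordsOver (range n) k
  words-as-wordsOver n zero    = refl
  words-as-wordsOver n (suc k) rewrite words-as-wordsOver n k | sym (map-upTo suc n) =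
    sym (concatMap-map (λ x → map (x ∷_) (wordsOver (map suc (upTo n)) k)) suc (upTo n))

  sum-wordsOver-suc : (F : List ℕ → ℕ) (A : List ℕ) (k : ℕ) →
    ΣL F (wordsOver A (suc k)) ≡ ∑[ x ← A ] ∑[ w ← wordsOver A k ] F (x ∷ w)
  sum-wordsOver-suc F A k = trans (ΣL-concatMap F _ A) (ΣL-ext (λ x → ΣL-map F (x ∷_) (wordsOver A k)) A)

  remove : ℕ → List ℕ → List ℕ
  remove x = filterᵇ (λ z → not (x ≡ᵇ z))

  ≢⇒kept : ∀ {x z} → x ≢ z → T (not (x ≡ᵇ z))
  ≢⇒kept x≢z rewrite ≢⇒≡ᵇ-false x≢z = _

  choices-distinct : (G : ℕ → List ℕ → ℕ) (L : List ℕ) → AllPairs _≢_ L →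
    ∑[ c ← choices L ] G (chosen c) (others c) ≡ ∑[ x ← L ] G x (remove x L)
  choices-distinct G []      []          = refl
  choices-distinct G (y ∷ L) (y∉L ∷ dL) = trans (sum-choices-∷ _ y L)
    (cong₂ _+_ (cong (G y) (sym remove-head))
               (trans (choices-distinct (λ x r → G x (y ∷ r)) L dL) (ΣL-cong (remove-later L y∉L))))
    where
    remove-head : remove y (y ∷ L) ≡ L
    remove-head rewrite ≡ᵇ-refl y = filter-all (T? ∘ λ z → not (y ≡ᵇ z)) (All.map ≢⇒kept y∉L)
    remove-later : (M : List ℕ) → All (y ≢_) M →
                   All (λ x → G x (y ∷ remove x L) ≡ G x (remove x (y ∷ L))) M
    remove-later []      []         = []
    remove-later (x ∷ M) (y≢x ∷ ys) =
      cong (G x) (sym (filter-accept (T? ∘ λ z → not (x ≡ᵇ z)) (≢⇒kept (y≢x ∘ sym)))) ∷ remove-later M ys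

  avoid-letter : (x : ℕ) (A : List ℕ) (k : ℕ) (F : List ℕ → ℕ) →
    ∑[ w ← wordsOver A k ] (b2n (notElem x w) * F w) ≡ ΣL F (wordsOver (remove x A) k)
  avoid-letter x A zero    F = cong (_+ 0) (*-identityˡ (F []))
  avoid-letter x A (suc k) F = begin
      ∑[ w ← wordsOver A (suc k) ] (b2n (notElem x w) * F w)
        ≡⟨ sum-wordsOver-suc _ A k ⟩
      ∑[ y ← A ] ∑[ w ← wordsOver A k ] (b2n (not (x ≡ᵇ y) ∧ notElem x w) * F (y ∷ w))
        ≡⟨ ΣL-ext (λ y → trans (ΣL-ext (λ w → split-indicator (not (x ≡ᵇ y)) (notElem x w) (F (y ∷ w))) (wordsOver A k))
                               (ΣL-*ˡ (b2n (not (x ≡ᵇ y))) _ (wordsOver A k))) A ⟩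
      ∑[ y ← A ] (b2n (not (x ≡ᵇ y)) * ∑[ w ← wordsOver A k ] (b2n (notElem x w) * F (y ∷ w)))
        ≡⟨ ΣL-ext (λ y → cong (b2n (not (x ≡ᵇ y)) *_) (avoid-letter x A k (F ∘ (y ∷_)))) A ⟩
      ∑[ y ← A ] (b2n (not (x ≡ᵇ y)) * ∑[ w ← wordsOver (remove x A) k ] F (y ∷ w))
        ≡⟨ sym (ΣL-filterᵇ _ _ A) ⟩
      ∑[ y ← remove x A ] ∑[ w ← wordsOver (remove x A) k ] F (y ∷ w)
        ≡⟨ sym (sum-wordsOver-suc F (remove x A) k) ⟩
      ΣL F (wordsOver (remove x A) (suc k)) ∎
    where open ≡-Reasoning

  distinct-words : (A : List ℕ) → AllPairs _≢_ A → (k : ℕ) (f : List ℕ → ℕ) →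
    ∑[ w ← wordsOver A k ] (b2n (distinct w) * f w) ≡ ∑[ α ← arrangements A k ] f (word α)
  distinct-words A dA zero    f = cong (_+ 0) (*-identityˡ (f []))
  distinct-words A dA (suc k) f = begin
      ∑[ w ← wordsOver A (suc k) ] (b2n (distinct w) * f w)
        ≡⟨ sum-wordsOver-suc _ A k ⟩
      ∑[ x ← A ] ∑[ w ← wordsOver A k ] (b2n (notElem x w ∧ distinct w) * f (x ∷ w))
        ≡⟨ ΣL-ext (λ x → ΣL-ext (λ w → split-indicator (notElem x w) (distinct w) (f (x ∷ w))) (wordsOver A k)) A ⟩
      ∑[ x ← A ] ∑[ w ← wordsOver A k ] (b2n (notElem x w) * (b2n (distinct w) * f (x ∷ w)))
        ≡⟨ ΣL-ext (λ x → avoid-letter x A k (λ w → b2n (distinct w) * f (x ∷ w))) A ⟩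
      ∑[ x ← A ] ∑[ w ← wordsOver (remove x A) k ] (b2n (distinct w) * f (x ∷ w))
        ≡⟨ ΣL-ext (λ x → distinct-words (remove x A) (AllPairsₚ.filter⁺ _ dA) k (f ∘ (x ∷_))) A ⟩
      ∑[ x ← A ] ∑[ α ← arrangements (remove x A) k ] f (x ∷ word α)
        ≡⟨ sym (choices-distinct (λ x r → ∑[ α ← arrangements r k ] f (x ∷ word α)) A dA) ⟩
      ∑[ c ← choices A ] ∑[ α ← arrangements (others c) k ] f (chosen c ∷ word α)
        ≡⟨ sym (sum-arrangements-suc (f ∘ word) A k) ⟩
      ∑[ α ← arrangements A (suc k) ] f (word α) ∎
    where open ≡-Reasoning

  perms-as-arrangements : ∀ n (f : List ℕ → ℕ) →
    ΣL f (perms n) ≡ ∑[ α ← arrangements (range n) n ] f (word α)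
  perms-as-arrangements n f = begin
      ΣL f (perms n)
        ≡⟨ ΣL-filterᵇ distinct f (words n n) ⟩
      ∑[ w ← words n n ] (b2n (distinct w) * f w)
        ≡⟨ cong (λ ws → ∑[ w ← ws ] (b2n (distinct w) * f w)) (words-as-wordsOver n n) ⟩
      ∑[ w ← wordsOver (range n) n ] (b2n (distinct w) * f w)
        ≡⟨ distinct-words (range n) (range-distinct n) n f ⟩
      ∑[ α ← arrangements (range n) n ] f (word α) ∎
    where open ≡-Reasoning

module Labellings where

  open import Data.Bool using (Bool; true; false; not; _∧_)
  open import Data.Nat
  open import Data.Nat.Properties
  open import Data.Nat.Combinatorics using (_C_; nCk+nC[k+1]≡[n+1]C[k+1])
  open import Data.List using (List; []; _∷_; _++_; length; upTo; take; drop)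
  open import Relation.Binary.PropositionalEquality
  open import Defs using (b2n)
  open Sums

  -- A descent rule decides whether adjacent entries x, y at a position of parity b
  -- (b = true at odd positions) form a descent.
  DescentRule : Set
  DescentRule = Bool → ℕ → ℕ → Bool

  shift : ℕ → Bool → Bool
  shift zero    b = b
  shift (suc g) b = shift g (not b)

  pascal : ∀ m L s → s ≤ L →
    ((suc m + suc L) ∸ suc s) C suc L ≡ ((m + suc L) ∸ suc s) C suc L + ((m + L) ∸ s) C L
  pascal m L s s≤L = begin
      ((suc m + suc L) ∸ suc s) C suc L   ≡⟨ cong (λ z → (z ∸ s) C suc L) (+-suc m L) ⟩
      (suc (m + L) ∸ s) C suc L           ≡⟨ cong (_C suc L) (+-∸-assoc 1 (≤-trans s≤L (m≤n+m L m))) ⟩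
      suc K C suc L                       ≡⟨ sym (nCk+nC[k+1]≡[n+1]C[k+1] K L) ⟩
      K C L + K C suc L                   ≡⟨ +-comm (K C L) (K C suc L) ⟩
      K C suc L + K C L                   ≡⟨ cong (λ z → (z ∸ suc s) C suc L + K C L) (sym (+-suc m L)) ⟩
      ((m + suc L) ∸ suc s) C suc L + K C L ∎
    where
    open ≡-Reasoning
    K = (m + L) ∸ s

  module _ (rule : DescentRule) where

    descents : Bool → List ℕ → ℕ
    descents b (x ∷ y ∷ r) = b2n (rule b x y) + descents (not b) (y ∷ r)
    descents b _           = 0

    descentFree : Bool → List ℕ → Bool
    descentFree b (x ∷ y ∷ r) = not (rule b x y) ∧ descentFree (not b) (y ∷ r)
    descentFree b _           = true

    descents-bound : ∀ b y w → descents b (y ∷ w) ≤ length w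
    descents-bound b y []      = z≤n
    descents-bound b y (z ∷ w) = +-mono-≤ (indicator-≤1 (rule b y z)) (descents-bound (not b) z w)
      where
      indicator-≤1 : ∀ c → b2n c ≤ 1
      indicator-≤1 true  = ≤-refl
      indicator-≤1 false = z≤n

    -- C(m + |w| - 1 - des w, |w|): the number of weakly increasing labellings of the
    -- positions of w by 1,…,m which increase strictly across every descent of w.
    labellings : Bool → List ℕ → ℕ → ℕ
    labellings b w m = ((m + length w) ∸ suc (descents b w)) C length w

    -- Splitting a labelling by 1,…,m+1 according to the block of the first g positions
    -- labelled 1: that block must be descent-free, the rest is labelled by 2,…,m+1.
    block : Bool → List ℕ → ℕ → ℕ → ℕ
    block b w m g = b2n (descentFree b (take g w)) * labellings (shift g b) (drop g w) m

    split : Bool → List ℕ → ℕ → ℕ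
    split b w m = ∑[ g ← upTo (suc (length w)) ] block b w m g

    block-++ : ∀ b α β m → block b (α ++ β) m (length α) ≡ b2n (descentFree b α) * labellings (shift (length α) b) β m
    block-++ b α β m = cong₂ (λ u v → b2n (descentFree b u) * labellings (shift (length α) b) v m) (take-++ α β) (drop-++ α β)
      where
      take-++ : (α β : List ℕ) → take (length α) (α ++ β) ≡ α
      take-++ []      β = refl
      take-++ (x ∷ α) β = cong (x ∷_) (take-++ α β)
      drop-++ : (α β : List ℕ) → drop (length α) (α ++ β) ≡ β
      drop-++ []      β = refl
      drop-++ (x ∷ α) β = drop-++ α β

    labellings-suc : ∀ b w m → labellings b w (suc m) ≡ split b w m
    -- The splits of x ∷ w whose block contains x: if x starts a descent only the block {x}
    -- is allowed, otherwise they are the splits of w; either way a binomial results.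
    later-blocks : ∀ b x w m →
      ∑[ g ← upTo (suc (length w)) ] block b (x ∷ w) m (suc g) ≡ ((m + length w) ∸ descents b (x ∷ w)) C length w

    labellings-suc b []      m = refl
    labellings-suc b (x ∷ w) m = begin
        labellings b (x ∷ w) (suc m)
          ≡⟨ pascal m (length w) (descents b (x ∷ w)) (descents-bound b x w) ⟩
        labellings b (x ∷ w) m + ((m + length w) ∸ descents b (x ∷ w)) C length w
          ≡⟨ cong₂ _+_ (sym (*-identityˡ _)) (sym (later-blocks b x w m)) ⟩
        block b (x ∷ w) m 0 + ∑[ g ← upTo (suc (length w)) ] block b (x ∷ w) m (suc g)
          ≡⟨ sym (ΣL-upTo-suc (block b (x ∷ w) m) (suc (length w))) ⟩
        split b (x ∷ w) m ∎
      where open ≡-Reasoning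

    later-blocks b x []      m = refl
    later-blocks b x (y ∷ w) m = by-first-step (rule b x y) refl (labellings-suc (not b) (y ∷ w) m)
      where
      open ≡-Reasoning
      s = descents (not b) (y ∷ w)
      n = suc (length w)
      tail-binomial : ∀ {d} → rule b x y ≡ d → ((m + n) ∸ (b2n d + s)) C n ≡ ((m + n) ∸ descents b (x ∷ y ∷ w)) C n
      tail-binomial d≡ = cong (λ d → ((m + n) ∸ (b2n d + s)) C n) (sym d≡)
      by-first-step : (d : Bool) → rule b x y ≡ d → labellings (not b) (y ∷ w) (suc m) ≡ split (not b) (y ∷ w) m →
        ∑[ g ← upTo (suc n) ] block b (x ∷ y ∷ w) m (suc g) ≡ ((m + n) ∸ descents b (x ∷ y ∷ w)) C n
      by-first-step true descent _ = begin
          ∑[ g ← upTo (suc n) ] block b (x ∷ y ∷ w) m (suc g)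
            ≡⟨ ΣL-upTo-suc (λ g → block b (x ∷ y ∷ w) m (suc g)) n ⟩
          1 * labellings (not b) (y ∷ w) m + ∑[ g ← upTo n ] block b (x ∷ y ∷ w) m (2 + g)
            ≡⟨ cong₂ _+_ (*-identityˡ _) (ΣL-zero blocked (upTo n)) ⟩
          labellings (not b) (y ∷ w) m + 0
            ≡⟨ trans (+-identityʳ _) (tail-binomial descent) ⟩
          ((m + n) ∸ descents b (x ∷ y ∷ w)) C n ∎
        where
        blocked : ∀ g → block b (x ∷ y ∷ w) m (2 + g) ≡ 0
        blocked g rewrite descent = refl
      by-first-step false ascent recursion = begin
          ∑[ g ← upTo (suc n) ] block b (x ∷ y ∷ w) m (suc g)
            ≡⟨ ΣL-ext continue (upTo (suc n)) ⟩
          split (not b) (y ∷ w) m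
            ≡⟨ sym recursion ⟩
          labellings (not b) (y ∷ w) (suc m)
            ≡⟨ tail-binomial ascent ⟩
          ((m + n) ∸ descents b (x ∷ y ∷ w)) C n ∎
        where
        continue : ∀ g → block b (x ∷ y ∷ w) m (suc g) ≡ block (not b) (y ∷ w) m g
        continue zero    = refl
        continue (suc g) rewrite ascent = refl

module DescentFreeArrangements where

  open import Data.Bool using (Bool; not; _∧_)
  open import Data.Nat
  open import Data.Nat.Properties
  open import Data.Nat.Combinatorics using (_C_)
  open import Data.List using (List; []; _∷_; map; zip; length)
  open import Data.List.Relation.Unary.All as All using (All; []; _∷_)
  open import Data.List.Relation.Unary.AllPairs using (AllPairs; []; _∷_)
  open import Data.Product using (_×_; _,_; proj₁; proj₂)
  open import Relation.Binary.PropositionalEquality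
  open import Defs using (b2n)
  open Sums
  open FallingFactorial
  open Arrangements
  open Permutations using (range; range-length; range-increasing)
  open Labellings using (DescentRule; descentFree)
  open BooleanComparisons
  open import Algebra.Properties.CommutativeSemigroup *-commutativeSemigroup using (xy∙z≈xz∙y)

  SameOrder : ℕ × ℕ → ℕ × ℕ → Set
  SameOrder (x , x′) (y , y′) = (x <ᵇ y) ≡ (x′ <ᵇ y′) × (y <ᵇ x) ≡ (y′ <ᵇ x′)

  SameOrder-sym : ∀ {p q} → SameOrder p q → SameOrder q p
  SameOrder-sym (lt , gt) = gt , lt

  zip-increasing : (S S′ : List ℕ) → AllPairs _<_ S → AllPairs _<_ S′ → AllPairs SameOrder (zip S S′)
  zip-increasing []      _        _          _            = []
  zip-increasing (s ∷ S) []       _          _            = []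
  zip-increasing (s ∷ S) (s′ ∷ S′) (s< ∷ inc) (s′< ∷ inc′) = heads S S′ s< s′< ∷ zip-increasing S S′ inc inc′
    where
    heads : (T T′ : List ℕ) → All (s <_) T → All (s′ <_) T′ → All (SameOrder (s , s′)) (zip T T′)
    heads []      _        _          _            = []
    heads (t ∷ T) []       _          _            = []
    heads (t ∷ T) (t′ ∷ T′) (s<t ∷ lt) (s′<t′ ∷ lt′) =
      (trans (<⇒<ᵇ-true s<t) (sym (<⇒<ᵇ-true s′<t′)) , trans (<⇒>ᵇ-false s<t) (sym (<⇒>ᵇ-false s′<t′)))
      ∷ heads T T′ lt lt′

  unzip-proj₁ : {A B : Set} (S : List A) (S′ : List B) → length S ≡ length S′ → map proj₁ (zip S S′) ≡ S
  unzip-proj₁ []      _        _ = refl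
  unzip-proj₁ (x ∷ S) (y ∷ S′) e = cong (x ∷_) (unzip-proj₁ S S′ (suc-injective e))

  unzip-proj₂ : {A B : Set} (S : List A) (S′ : List B) → length S ≡ length S′ → map proj₂ (zip S S′) ≡ S′
  unzip-proj₂ []      []       _ = refl
  unzip-proj₂ (x ∷ S) (y ∷ S′) e = cong (y ∷_) (unzip-proj₂ S S′ (suc-injective e))

  Comparative : DescentRule → Set
  Comparative rule = ∀ b x y x′ y′ → SameOrder (x , x′) (y , y′) → rule b x y ≡ rule b x′ y′

  descentFreeCount : DescentRule → Bool → List ℕ → ℕ → ℕ
  descentFreeCount rule b S g = ∑[ α ← arrangements S g ] b2n (descentFree rule b (word α))

  module _ (rule : DescentRule) (comparative : Comparative rule) where

    descentFree-same-order : ∀ b z → AllPairs SameOrder z →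
                             descentFree rule b (map proj₁ z) ≡ descentFree rule b (map proj₂ z)
    descentFree-same-order b []          _                = refl
    descentFree-same-order b (p ∷ [])    _                = refl
    descentFree-same-order b (p ∷ q ∷ z) ((pq ∷ _) ∷ ord) =
      cong₂ (λ u v → not u ∧ v) (comparative b _ _ _ _ pq) (descentFree-same-order (not b) (q ∷ z) ord)

    same-order-count : ∀ b k S S′ → AllPairs _<_ S → AllPairs _<_ S′ → length S ≡ length S′ →
                       descentFreeCount rule b S k ≡ descentFreeCount rule b S′ k
    same-order-count b k S S′ inc inc′ e = begin
        descentFreeCount rule b S k
          ≡⟨ cong (λ T → descentFreeCount rule b T k) (sym (unzip-proj₁ S S′ e)) ⟩
        descentFreeCount rule b (map proj₁ Z) k
          ≡⟨ arrangements-map proj₁ k (λ α → b2n (descentFree rule b (word α))) Z ⟩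
        ∑[ α ← arrangements Z k ] b2n (descentFree rule b (map proj₁ (word α)))
          ≡⟨ ΣL-cong (All.map (λ {α} (ord , _) → cong b2n (descentFree-same-order b (word α) ord))
                              (word-AllPairs {R = SameOrder} (λ {p} {q} → SameOrder-sym {p} {q}) k Z (zip-increasing S S′ inc inc′))) ⟩
        ∑[ α ← arrangements Z k ] b2n (descentFree rule b (map proj₂ (word α)))
          ≡⟨ sym (arrangements-map proj₂ k (λ α → b2n (descentFree rule b (word α))) Z) ⟩
        descentFreeCount rule b (map proj₂ Z) k
          ≡⟨ cong (λ T → descentFreeCount rule b T k) (unzip-proj₂ S S′ e) ⟩
        descentFreeCount rule b S′ k ∎
      where
      open ≡-Reasoning
      Z = zip S S′

    -- Proof: count the pairs
    -- (g-arrangement α, ordering of the other l = |S|-g entries) in two ways; read the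
    -- other way round they are an l-arrangement β followed by an ordering of rest β.
    descentFree-count : (a : ℕ → ℕ) → (∀ b g → descentFreeCount rule b (range g) g ≡ a g) →
      ∀ b S g → AllPairs _<_ S → g ≤ length S → descentFreeCount rule b S g ≡ (length S C g) * a g
    descentFree-count a base b S g inc g≤N = *-cancelʳ-≡ _ _ (l !) {{l !≢0}} (begin
        descentFreeCount rule b S g * l !
          ≡⟨ sym (ΣL-*ʳ (l !) _ (arrangements S g)) ⟩
        ∑[ α ← arrangements S g ] (b2n (descentFree rule b (word α)) * l !)
          ≡⟨ ΣL-cong (All.map (λ {α} (_ , er) → orderings-of-rest α (rest-length g S α er)) (arrangements-length g S)) ⟩
        ∑[ α ← arrangements S g ] ∑[ β ← arrangements (rest α) l ] b2n (descentFree rule b (word α))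
          ≡⟨ arrangements-swap g l (λ u _ _ → b2n (descentFree rule b u)) S ⟩
        ∑[ β ← arrangements S l ] descentFreeCount rule b (rest β) g
          ≡⟨ ΣL-cong (All.zipWith (λ {β} ((_ , er) , inc-r) → reference β (trans (rest-length l S β er) (m∸[m∸n]≡n g≤N)) inc-r)
                                  (arrangements-length l S , rest-AllPairs l S inc)) ⟩
        ∑[ β ← arrangements S l ] a g
          ≡⟨ ΣL-const (a g) (arrangements S l) ⟩
        length (arrangements S l) * a g
          ≡⟨ cong (_* a g) (trans (arrangements-count l S) (sym (binomial-fall N g g≤N))) ⟩
        (N C g) * l ! * a g
          ≡⟨ xy∙z≈xz∙y (N C g) (l !) (a g) ⟩
        (N C g) * a g * l ! ∎)
      where
      open ≡-Reasoning
      N = length S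
      l = N ∸ g
      orderings-of-rest : ∀ α → length (rest α) ≡ l →
        b2n (descentFree rule b (word α)) * l ! ≡ ∑[ β ← arrangements (rest α) l ] b2n (descentFree rule b (word α))
      orderings-of-rest α e = sym (begin
          ∑[ β ← arrangements (rest α) l ] b2n (descentFree rule b (word α))
            ≡⟨ ΣL-const _ (arrangements (rest α) l) ⟩
          length (arrangements (rest α) l) * b2n (descentFree rule b (word α))
            ≡⟨ cong (_* _) (trans (arrangements-count l (rest α)) (trans (cong (λ n → fall n l) e) (fall-! l))) ⟩
          l ! * b2n (descentFree rule b (word α))
            ≡⟨ *-comm (l !) _ ⟩
          b2n (descentFree rule b (word α)) * l ! ∎)
      reference : ∀ β → length (rest β) ≡ g → AllPairs _<_ (rest β) → descentFreeCount rule b (rest β) g ≡ a g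
      reference β e inc-r = trans (same-order-count b g (rest β) (range g) inc-r (range-increasing g)
                                                    (trans e (sym (range-length g))))
                                  (base b g)

module Worpitzky where

  open import Data.Bool using (Bool)
  open import Data.Nat
  open import Data.Nat.Properties
  open import Data.Nat.Combinatorics using (_C_; k>n⇒nCk≡0)
  open import Data.List using (List; []; _∷_; _++_; length; upTo)
  open import Data.List.Relation.Unary.All as All using (All; []; _∷_)
  open import Data.List.Relation.Unary.All.Properties using (all-upTo)
  open import Data.List.Relation.Unary.AllPairs using (AllPairs)
  open import Data.Product using (_,_)
  open import Relation.Binary.PropositionalEquality
  open import Defs using (b2n)
  open Sums
  open Arrangements
  open Labellings
  open DescentFreeArrangements using (descentFreeCount)

  -- gOnes a n m = g_{f,n}(1^m) for f = 1 + Σ aₙ xⁿ/n!, computed by the recursion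
  -- obtained from splitting off the variable x₁: it takes a block of g of the n
  -- letters (C(n,g) choices, weight a_g), the other n-g letters go to x₂,…,x_{m+1}.
  gOnes : (ℕ → ℕ) → ℕ → ℕ → ℕ
  gOnes a n       (suc m) = ∑[ g ← upTo (suc n) ] ((n C g) * a g * gOnes a (n ∸ g) m)
  gOnes a zero    zero    = 1
  gOnes a (suc n) zero    = 0

  module _ (rule : DescentRule) (a : ℕ → ℕ)
    (descentFree-count : ∀ b S g → AllPairs _<_ S → g ≤ length S → descentFreeCount rule b S g ≡ (length S C g) * a g) where

    totalLabellings : Bool → List ℕ → ℕ → ℕ
    totalLabellings b S m = ∑[ α ← arrangements S (length S) ] labellings rule b (word α) m

    worpitzky : ∀ m b S → AllPairs _<_ S → totalLabellings b S m ≡ gOnes a (length S) m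

    first-block : ∀ m b S → AllPairs _<_ S → ∀ g → g ≤ length S →
      ∑[ α ← arrangements S (length S) ] block rule b (word α) m g ≡ (length S C g) * a g * gOnes a (length S ∸ g) m
    first-block m b S inc g g≤N = begin
        ∑[ α ← arrangements S N ] block rule b (word α) m g
          ≡⟨ cong (λ k → ∑[ α ← arrangements S k ] block rule b (word α) m g) (sym (m+[n∸m]≡n g≤N)) ⟩
        ∑[ α ← arrangements S (g + l) ] block rule b (word α) m g
          ≡⟨ sum-arrangements-+ g l (λ α → block rule b (word α) m g) S ⟩
        ∑[ α ← arrangements S g ] ∑[ β ← arrangements (rest α) l ] block rule b (word α ++ word β) m g
          ≡⟨ ΣL-cong (All.zipWith (λ {α} ((ew , er) , inc-r) → separate α ew (rest-length g S α er) inc-r)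
                                   (arrangements-length g S , rest-AllPairs g S inc)) ⟩
        ∑[ α ← arrangements S g ] (b2n (descentFree rule b (word α)) * gOnes a l m)
          ≡⟨ ΣL-*ʳ (gOnes a l m) _ (arrangements S g) ⟩
        (∑[ α ← arrangements S g ] b2n (descentFree rule b (word α))) * gOnes a l m
          ≡⟨ cong (_* gOnes a l m) (descentFree-count b S g inc g≤N) ⟩
        (N C g) * a g * gOnes a l m ∎
      where
      open ≡-Reasoning
      N = length S
      l = N ∸ g
      separate : ∀ α → length (word α) ≡ g → length (rest α) ≡ l → AllPairs _<_ (rest α) →
        ∑[ β ← arrangements (rest α) l ] block rule b (word α ++ word β) m g ≡ b2n (descentFree rule b (word α)) * gOnes a l m
      separate α refl el inc-r = begin
          ∑[ β ← arrangements (rest α) l ] block rule b (word α ++ word β) m g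
            ≡⟨ ΣL-ext (λ β → block-++ rule b (word α) (word β) m) (arrangements (rest α) l) ⟩
          ∑[ β ← arrangements (rest α) l ] (b2n (descentFree rule b (word α)) * labellings rule (shift g b) (word β) m)
            ≡⟨ ΣL-*ˡ (b2n (descentFree rule b (word α))) (λ β → labellings rule (shift g b) (word β) m) (arrangements (rest α) l) ⟩
          b2n (descentFree rule b (word α)) * ∑[ β ← arrangements (rest α) l ] labellings rule (shift g b) (word β) m
            ≡⟨ cong (b2n (descentFree rule b (word α)) *_) remaining ⟩
          b2n (descentFree rule b (word α)) * gOnes a l m ∎
        where
        remaining : ∑[ β ← arrangements (rest α) l ] labellings rule (shift g b) (word β) m ≡ gOnes a l m
        remaining = begin
          ∑[ β ← arrangements (rest α) l ] labellings rule (shift g b) (word β) m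
            ≡⟨ cong (λ k → ∑[ β ← arrangements (rest α) k ] labellings rule (shift g b) (word β) m) (sym el) ⟩
          totalLabellings (shift g b) (rest α) m
            ≡⟨ worpitzky m (shift g b) (rest α) inc-r ⟩
          gOnes a (length (rest α)) m
            ≡⟨ cong (λ k → gOnes a k m) el ⟩
          gOnes a l m ∎

    worpitzky zero b []      _   = refl
    worpitzky zero b (x ∷ S) _   =
      ΣL-zero-on (All.map (λ {α} (ew , _) → no-labels (word α) ew) (arrangements-length (suc (length S)) (x ∷ S)))
      where
      no-labels : ∀ w → length w ≡ suc (length S) → labellings rule b w 0 ≡ 0
      no-labels w ew rewrite ew = k>n⇒nCk≡0 (s≤s (m∸n≤m (length S) (descents rule b w)))
    worpitzky (suc m) b S inc = begin
        ∑[ α ← arrangements S N ] labellings rule b (word α) (suc m)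
          ≡⟨ ΣL-cong (All.map (λ {α} (ew , _) → trans (labellings-suc rule b (word α) m)
                                                    (cong (λ k → ∑[ g ← upTo (suc k) ] block rule b (word α) m g) ew))
                              (arrangements-length N S)) ⟩
        ∑[ α ← arrangements S N ] ∑[ g ← upTo (suc N) ] block rule b (word α) m g
          ≡⟨ ΣL-swap (λ α g → block rule b (word α) m g) (arrangements S N) (upTo (suc N)) ⟩
        ∑[ g ← upTo (suc N) ] ∑[ α ← arrangements S N ] block rule b (word α) m g
          ≡⟨ ΣL-cong (All.map (λ {g} g<1+N → first-block m b S inc g (s≤s⁻¹ g<1+N)) (all-upTo (suc N))) ⟩
        gOnes a N (suc m) ∎
      where
      open ≡-Reasoning
      N = length S

module QuasisymmetricAtOnes where

  open import Data.Nat
  open import Data.Nat.Properties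
  open import Data.Nat.Combinatorics using (_C_)
  open import Data.Nat.Solver using (module +-*-Solver)
  open import Data.Integer as ℤ using (ℤ; +_)
  import Data.Integer.Properties as ℤₚ
  open import Data.List using (List; []; _∷_; map; foldr; upTo)
  open import Data.Nat.ListAction using (product)
  open import Data.List.Properties using (concatMap-cong)
  open import Relation.Binary.PropositionalEquality
  open import Defs using (compsF; compositions; multinomial; evalM; productℤ; evalG; ones)
  open Sums
  open Worpitzky using (gOnes)
  open +-*-Solver

  monomialOnes : List ℕ → ℕ → ℕ
  monomialOnes []      _       = 1
  monomialOnes (g ∷ γ) zero    = 0
  monomialOnes (g ∷ γ) (suc m) = monomialOnes γ m + monomialOnes (g ∷ γ) m

  evalM-ones : ∀ γ m → evalM γ (ones m) ≡ + monomialOnes γ m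
  evalM-ones []      m       = refl
  evalM-ones (g ∷ γ) zero    = refl
  evalM-ones (g ∷ γ) (suc m) = begin
      ((+ 1) ℤ.^ g) ℤ.* evalM γ (ones m) ℤ.+ evalM (g ∷ γ) (ones m)
        ≡⟨ cong₂ (λ u v → u ℤ.* evalM γ (ones m) ℤ.+ v) (ℤₚ.^-zeroˡ g) (evalM-ones (g ∷ γ) m) ⟩
      + 1 ℤ.* evalM γ (ones m) ℤ.+ + monomialOnes (g ∷ γ) m
        ≡⟨ cong (ℤ._+ + monomialOnes (g ∷ γ) m) (trans (ℤₚ.*-identityˡ _) (evalM-ones γ m)) ⟩
      + monomialOnes γ m ℤ.+ + monomialOnes (g ∷ γ) m
        ≡⟨ sym (ℤₚ.pos-+ (monomialOnes γ m) _) ⟩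
      + monomialOnes (g ∷ γ) (suc m) ∎
    where open ≡-Reasoning

  productℤ-pos : ∀ xs → productℤ xs ≡ + product xs
  productℤ-pos []       = refl
  productℤ-pos (x ∷ xs) = trans (cong (+ x ℤ.*_) (productℤ-pos xs)) (sym (ℤₚ.pos-* x (product xs)))

  compsF-fuel : ∀ f₁ f₂ k → k ≤ f₁ → k ≤ f₂ → compsF f₁ k ≡ compsF f₂ k
  compsF-fuel f₁        f₂        zero    _         _         = refl
  compsF-fuel (suc f₁) (suc f₂) (suc k) (s≤s k≤f₁) (s≤s k≤f₂) = concatMap-cong
    (λ j → cong (map (suc j ∷_)) (compsF-fuel f₁ f₂ (k ∸ j) (≤-trans (m∸n≤m k j) k≤f₁) (≤-trans (m∸n≤m k j) k≤f₂)))
    (upTo (suc k))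

  module _ (a : ℕ → ℕ) where

    term : ℕ → ℕ → List ℕ → ℕ
    term n m γ = multinomial n γ * product (map a γ) * monomialOnes γ m

    gSum : ℕ → ℕ → ℕ
    gSum n m = ∑[ γ ← compositions n ] term n m γ

    evalG-ones : ∀ n m → evalG a n (ones m) ≡ + gSum n m
    evalG-ones n m = sum-pos (compositions n)
      where
      sum-pos : ∀ Γ → foldr ℤ._+_ (+ 0) (map (λ γ → + multinomial n γ ℤ.* productℤ (map a γ) ℤ.* evalM γ (ones m)) Γ)
                      ≡ + ∑[ γ ← Γ ] term n m γ
      sum-pos []      = refl
      sum-pos (γ ∷ Γ) = trans (cong₂ ℤ._+_ term-pos (sum-pos Γ)) (sym (ℤₚ.pos-+ (term n m γ) _))
        where
        term-pos : + multinomial n γ ℤ.* productℤ (map a γ) ℤ.* evalM γ (ones m) ≡ + term n m γ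
        term-pos = begin
            + multinomial n γ ℤ.* productℤ (map a γ) ℤ.* evalM γ (ones m)
              ≡⟨ cong₂ (λ u v → + multinomial n γ ℤ.* u ℤ.* v) (productℤ-pos (map a γ)) (evalM-ones γ m) ⟩
            + multinomial n γ ℤ.* + product (map a γ) ℤ.* + monomialOnes γ m
              ≡⟨ cong (ℤ._* + monomialOnes γ m) (sym (ℤₚ.pos-* (multinomial n γ) _)) ⟩
            + (multinomial n γ * product (map a γ)) ℤ.* + monomialOnes γ m
              ≡⟨ sym (ℤₚ.pos-* (multinomial n γ * product (map a γ)) (monomialOnes γ m)) ⟩
            + term n m γ ∎
          where open ≡-Reasoning

    -- With x₁ = 1, the term of γ = g ∷ γ′ splits by whether x₁ is used (by the part g).
    term-suc : ∀ n m g γ → term n (suc m) (g ∷ γ) ≡ term n m (g ∷ γ) + (n C g) * a g * term (n ∸ g) m γ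
    term-suc n m g γ = solve 6 (λ c μ α p M M′ → c :* μ :* (α :* p) :* (M :+ M′)
                                             := c :* μ :* (α :* p) :* M′ :+ c :* α :* (μ :* p :* M))
                               refl (n C g) (multinomial (n ∸ g) γ) (a g) (product (map a γ))
                               (monomialOnes γ m) (monomialOnes (g ∷ γ) m)

    gSum-by-first-part : ∀ n m → gSum (suc n) m ≡ ∑[ j ← upTo (suc n) ] ∑[ γ ← compsF n (n ∸ j) ] term (suc n) m (suc j ∷ γ)
    gSum-by-first-part n m = trans (ΣL-concatMap (term (suc n) m) (λ j → map (suc j ∷_) (compsF n (n ∸ j))) (upTo (suc n)))
      (ΣL-ext (λ j → ΣL-map (term (suc n) m) (suc j ∷_) (compsF n (n ∸ j))) (upTo (suc n)))

    gSum-suc : a 0 ≡ 1 → ∀ n m → gSum n (suc m) ≡ ∑[ g ← upTo (suc n) ] ((n C g) * a g * gSum (n ∸ g) m)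
    gSum-suc a₀ zero    m rewrite a₀ = refl
    gSum-suc a₀ (suc n) m = begin
        gSum (suc n) (suc m)
          ≡⟨ gSum-by-first-part n (suc m) ⟩
        ∑[ j ← upTo (suc n) ] ∑[ γ ← compsF n (n ∸ j) ] term (suc n) (suc m) (suc j ∷ γ)
          ≡⟨ ΣL-ext (λ j → trans (ΣL-ext (term-suc (suc n) m (suc j)) (compsF n (n ∸ j)))
                                 (ΣL-+ (λ γ → term (suc n) m (suc j ∷ γ)) (λ γ → c j * term (n ∸ j) m γ) (compsF n (n ∸ j))))
                    (upTo (suc n)) ⟩
        ∑[ j ← upTo (suc n) ] (x₁-unused j + x₁-used j)
          ≡⟨ ΣL-+ x₁-unused x₁-used (upTo (suc n)) ⟩
        ΣL x₁-unused (upTo (suc n)) + ΣL x₁-used (upTo (suc n))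
          ≡⟨ cong₂ _+_ (sym (gSum-by-first-part n m)) (ΣL-ext later-parts (upTo (suc n))) ⟩
        gSum (suc n) m + ∑[ j ← upTo (suc n) ] (c j * gSum (n ∸ j) m)
          ≡⟨ cong (_+ ∑[ j ← upTo (suc n) ] (c j * gSum (n ∸ j) m)) (sym first-part-unused) ⟩
        (suc n C 0) * a 0 * gSum (suc n) m + ∑[ j ← upTo (suc n) ] (c j * gSum (n ∸ j) m)
          ≡⟨ sym (ΣL-upTo-suc (λ g → (suc n C g) * a g * gSum (suc n ∸ g) m) (suc n)) ⟩
        ∑[ g ← upTo (suc (suc n)) ] ((suc n C g) * a g * gSum (suc n ∸ g) m) ∎
      where
      open ≡-Reasoning
      c : ℕ → ℕ
      c j = (suc n C suc j) * a (suc j)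
      x₁-unused x₁-used : ℕ → ℕ
      x₁-unused j = ∑[ γ ← compsF n (n ∸ j) ] term (suc n) m (suc j ∷ γ)
      x₁-used   j = ∑[ γ ← compsF n (n ∸ j) ] (c j * term (n ∸ j) m γ)
      later-parts : ∀ j → x₁-used j ≡ c j * gSum (n ∸ j) m
      later-parts j = trans (ΣL-*ˡ (c j) (term (n ∸ j) m) (compsF n (n ∸ j)))
                            (cong (λ Γ → c j * ΣL (term (n ∸ j) m) Γ) (compsF-fuel n (n ∸ j) (n ∸ j) (m∸n≤m n j) ≤-refl))
      first-part-unused : (suc n C 0) * a 0 * gSum (suc n) m ≡ gSum (suc n) m
      first-part-unused rewrite a₀ = +-identityʳ (gSum (suc n) m)

    -- Hence gSum is gOnes (for a₀ = 1, as f(0) = 1).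
    gSum≡gOnes : a 0 ≡ 1 → ∀ m n → gSum n m ≡ gOnes a n m
    gSum≡gOnes a₀ zero    zero    = refl
    gSum≡gOnes a₀ zero    (suc n) = trans (gSum-by-first-part n 0)
      (ΣL-zero (λ j → ΣL-zero (λ γ → *-zeroʳ (multinomial (suc n) (suc j ∷ γ) * product (map a (suc j ∷ γ))))
                              (compsF n (n ∸ j))) (upTo (suc n)))
    gSum≡gOnes a₀ (suc m) n = trans (gSum-suc a₀ n m)
      (ΣL-ext (λ g → cong ((n C g) * a g *_) (gSum≡gOnes a₀ m (n ∸ g))) (upTo (suc n)))

module PowerSeries where

  open import Data.Nat as ℕ using (ℕ; zero; suc; _∸_; _≤_; z≤n)
  import Data.Nat.Properties as ℕₚ
  open import Data.Nat.Combinatorics using (_C_; nCk+nC[k+1]≡[n+1]C[k+1]; nCn≡1)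
  open import Data.Integer using (ℤ; +_; _+_; _*_; _-_; -_)
  import Data.Integer.Properties as ℤₚ
  open import Data.Integer.Solver using (module +-*-Solver)
  open import Relation.Binary.PropositionalEquality
  open import Function using (_∘_)
  open import Defs using (Series; sumTo; _⊛_; oneS; oneMinusT; _^S_)
  open +-*-Solver

  sumTo-shift : ∀ k (f : ℕ → ℤ) → sumTo (suc k) f ≡ f 0 + sumTo k (f ∘ suc)
  sumTo-shift zero    f = refl
  sumTo-shift (suc k) f = trans (cong (_+ f (suc (suc k))) (sumTo-shift k f)) (ℤₚ.+-assoc (f 0) _ _)

  sumTo-cong : ∀ k {f g : ℕ → ℤ} → (∀ i → i ≤ k → f i ≡ g i) → sumTo k f ≡ sumTo k g
  sumTo-cong zero    e = e 0 z≤n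
  sumTo-cong (suc k) e = cong₂ _+_ (sumTo-cong k (λ i i≤k → e i (ℕₚ.m≤n⇒m≤1+n i≤k))) (e (suc k) ℕₚ.≤-refl)

  sumTo-zero : ∀ k → sumTo k (λ _ → + 0) ≡ + 0
  sumTo-zero zero    = refl
  sumTo-zero (suc k) = cong (_+ + 0) (sumTo-zero k)

  sumTo-- : ∀ k (f g : ℕ → ℤ) → sumTo k (λ i → f i - g i) ≡ sumTo k f - sumTo k g
  sumTo-- zero    f g = refl
  sumTo-- (suc k) f g = trans (cong (_+ (f (suc k) - g (suc k))) (sumTo-- k f g))
    (solve 4 (λ a b c d → (a :- b) :+ (c :- d) := (a :+ c) :- (b :+ d)) refl
           (sumTo k f) (sumTo k g) (f (suc k)) (g (suc k)))

  ⊛-congˡ : ∀ {A A′ : Series} (B : Series) → A ≗ A′ → (A ⊛ B) ≗ (A′ ⊛ B)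
  ⊛-congˡ B e k = sumTo-cong k (λ i _ → cong (_* B (k ∸ i)) (e i))

  ⊛-congʳ : ∀ (A : Series) {B B′ : Series} → B ≗ B′ → (A ⊛ B) ≗ (A ⊛ B′)
  ⊛-congʳ A e k = sumTo-cong k (λ i _ → cong (A i *_) (e (k ∸ i)))

  oneS-⊛ : ∀ (G : Series) → (oneS ⊛ G) ≗ G
  oneS-⊛ G zero    = ℤₚ.*-identityˡ (G 0)
  oneS-⊛ G (suc k) = trans (sumTo-shift k _)
    (trans (cong₂ _+_ (ℤₚ.*-identityˡ (G (suc k))) (sumTo-zero k)) (ℤₚ.+-identityʳ _))

  ⊛-oneS : ∀ (A : Series) → (A ⊛ oneS) ≗ A
  ⊛-oneS A zero    = ℤₚ.*-identityʳ (A 0)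
  ⊛-oneS A (suc k) = trans
    (cong₂ _+_ (trans (sumTo-cong k (λ i i≤k → trans (cong (λ j → A i * oneS j) (ℕₚ.+-∸-assoc 1 i≤k)) (ℤₚ.*-zeroʳ (A i))))
                      (sumTo-zero k))
               (trans (cong (λ j → A (suc k) * oneS j) (ℕₚ.n∸n≡0 k)) (ℤₚ.*-identityʳ (A (suc k)))))
    (ℤₚ.+-identityˡ (A (suc k)))

  Δ : Series → Series
  Δ F zero    = F 0
  Δ F (suc k) = F (suc k) - F k

  Δ-cong : ∀ {F G : Series} → F ≗ G → Δ F ≗ Δ G
  Δ-cong e zero    = e 0
  Δ-cong e (suc k) = cong₂ _-_ (e (suc k)) (e k)

  oneMinusT-⊛ : ∀ (F : Series) → (oneMinusT ⊛ F) ≗ Δ F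
  oneMinusT-⊛ F zero    = ℤₚ.*-identityˡ (F 0)
  oneMinusT-⊛ F (suc k) = trans (sumTo-shift k _) (cong₂ _+_ (ℤₚ.*-identityˡ (F (suc k))) (minus-previous k))
    where
    minus-previous : ∀ k → sumTo k (λ i → oneMinusT (suc i) * F (k ∸ i)) ≡ - F k
    minus-previous zero    = ℤₚ.-1*i≡-i (F 0)
    minus-previous (suc k) = trans (sumTo-shift k _)
      (trans (cong₂ _+_ (ℤₚ.-1*i≡-i (F (suc k))) (sumTo-zero k)) (ℤₚ.+-identityʳ _))

  Δ-⊛ʳ : ∀ (A B : Series) → Δ (A ⊛ B) ≗ (A ⊛ Δ B)
  Δ-⊛ʳ A B zero    = refl
  Δ-⊛ʳ A B (suc k) = begin
      (sumTo k (λ i → A i * B (suc k ∸ i)) + A (suc k) * B (k ∸ k)) - sumTo k (λ i → A i * B (k ∸ i))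
        ≡⟨ cong (λ j → (sumTo k (λ i → A i * B (suc k ∸ i)) + A (suc k) * B j) - sumTo k (λ i → A i * B (k ∸ i))) (ℕₚ.n∸n≡0 k) ⟩
      (sumTo k (λ i → A i * B (suc k ∸ i)) + A (suc k) * B 0) - sumTo k (λ i → A i * B (k ∸ i))
        ≡⟨ solve 3 (λ x y z → (x :+ y) :- z := (x :- z) :+ y) refl (sumTo k (λ i → A i * B (suc k ∸ i))) (A (suc k) * B 0) _ ⟩
      (sumTo k (λ i → A i * B (suc k ∸ i)) - sumTo k (λ i → A i * B (k ∸ i))) + A (suc k) * B 0
        ≡⟨ cong (_+ A (suc k) * B 0) (trans (sym (sumTo-- k _ _)) (sumTo-cong k difference)) ⟩
      sumTo k (λ i → A i * Δ B (suc k ∸ i)) + A (suc k) * B 0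
        ≡⟨ cong (λ j → sumTo k (λ i → A i * Δ B (suc k ∸ i)) + A (suc k) * Δ B j) (sym (ℕₚ.n∸n≡0 k)) ⟩
      sumTo k (λ i → A i * Δ B (suc k ∸ i)) + A (suc k) * Δ B (k ∸ k) ∎
    where
    open ≡-Reasoning
    difference : ∀ i → i ≤ k → A i * B (suc k ∸ i) - A i * B (k ∸ i) ≡ A i * Δ B (suc k ∸ i)
    difference i i≤k rewrite ℕₚ.+-∸-assoc 1 i≤k =
      solve 3 (λ x y z → x :* y :- x :* z := x :* (y :- z)) refl (A i) (B (suc (k ∸ i))) (B (k ∸ i))

  Δ-⊛ˡ : ∀ (A B : Series) → (Δ A ⊛ B) ≗ Δ (A ⊛ B)
  Δ-⊛ˡ A B zero    = refl
  Δ-⊛ˡ A B (suc k) = begin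
      sumTo (suc k) (λ i → Δ A i * B (suc k ∸ i))
        ≡⟨ sumTo-shift k _ ⟩
      A 0 * B (suc k) + sumTo k (λ i → (A (suc i) - A i) * B (k ∸ i))
        ≡⟨ cong (λ z → A 0 * B (suc k) + z)
             (trans (sumTo-cong k (λ i _ → solve 3 (λ x y z → (x :- y) :* z := x :* z :- y :* z) refl (A (suc i)) (A i) (B (k ∸ i))))
                    (sumTo-- k _ _)) ⟩
      A 0 * B (suc k) + (sumTo k (λ i → A (suc i) * B (k ∸ i)) - sumTo k (λ i → A i * B (k ∸ i)))
        ≡⟨ solve 3 (λ x y z → x :+ (y :- z) := (x :+ y) :- z) refl (A 0 * B (suc k)) _ _ ⟩
      (A 0 * B (suc k) + sumTo k (λ i → A (suc i) * B (k ∸ i))) - sumTo k (λ i → A i * B (k ∸ i))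
        ≡⟨ cong (_- sumTo k (λ i → A i * B (k ∸ i))) (sym (sumTo-shift k _)) ⟩
      Δ (A ⊛ B) (suc k) ∎
    where open ≡-Reasoning

  oneMinusT-⊛-⊛ : ∀ (P G : Series) → ((oneMinusT ⊛ P) ⊛ G) ≗ (P ⊛ Δ G)
  oneMinusT-⊛-⊛ P G k = trans (⊛-congˡ G (oneMinusT-⊛ P) k) (trans (Δ-⊛ˡ P G k) (Δ-⊛ʳ P G k))

  Δ^ : ℕ → Series → Series
  Δ^ zero    G = G
  Δ^ (suc p) G = Δ^ p (Δ G)

  Δ^-cong : ∀ p {F G : Series} → F ≗ G → Δ^ p F ≗ Δ^ p G
  Δ^-cong zero    e = e
  Δ^-cong (suc p) e = Δ^-cong p (Δ-cong e)

  oneMinusT^-⊛ : ∀ p (G : Series) → ((oneMinusT ^S p) ⊛ G) ≗ Δ^ p G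
  oneMinusT^-⊛ zero    G k = oneS-⊛ G k
  oneMinusT^-⊛ (suc p) G k = trans (oneMinusT-⊛-⊛ (oneMinusT ^S p) G k) (oneMinusT^-⊛ p (Δ G) k)

  -- The coefficients C(j+q, q) of 1/(1-t)^{q+1}.
  binomialSeries : ℕ → Series
  binomialSeries q j = + ((j ℕ.+ q) C q)

  Δ-binomialSeries : ∀ q → Δ (binomialSeries (suc q)) ≗ binomialSeries q
  Δ-binomialSeries q zero    = cong +_ (trans (nCn≡1 (suc q)) (sym (nCn≡1 q)))
  Δ-binomialSeries q (suc j) = begin
      + ((suc j ℕ.+ suc q) C suc q) - + (K C suc q)
        ≡⟨ cong (λ z → + z - + (K C suc q)) (sym (nCk+nC[k+1]≡[n+1]C[k+1] K q)) ⟩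
      + (K C q ℕ.+ K C suc q) - + (K C suc q)
        ≡⟨ cong (_- + (K C suc q)) (ℤₚ.pos-+ (K C q) (K C suc q)) ⟩
      (+ (K C q) + + (K C suc q)) - + (K C suc q)
        ≡⟨ solve 2 (λ x y → (x :+ y) :- y := x) refl (+ (K C q)) (+ (K C suc q)) ⟩
      + (K C q)
        ≡⟨ cong (λ z → + (z C q)) (ℕₚ.+-suc j q) ⟩
      binomialSeries q (suc j) ∎
    where
    open ≡-Reasoning
    K = j ℕ.+ suc q

  Δ-binomialSeries-0 : Δ (binomialSeries 0) ≗ oneS
  Δ-binomialSeries-0 zero    = refl
  Δ-binomialSeries-0 (suc j) = refl

  Δ^-binomialSeries : ∀ q (A : Series) → Δ^ (suc q) (A ⊛ binomialSeries q) ≗ A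
  Δ^-binomialSeries zero    A k = trans (Δ-⊛ʳ A (binomialSeries 0) k) (trans (⊛-congʳ A Δ-binomialSeries-0 k) (⊛-oneS A k))
  Δ^-binomialSeries (suc q) A k =
    trans (Δ^-cong (suc q) (λ j → trans (Δ-⊛ʳ A (binomialSeries (suc q)) j) (⊛-congʳ A (Δ-binomialSeries q) j)) k)
          (Δ^-binomialSeries q A k)

  divide-by-power : ∀ n (A G : Series) → G ≗ (A ⊛ binomialSeries n) → A ≗ ((oneMinusT ^S (n ℕ.+ 1)) ⊛ G)
  divide-by-power n A G e k = sym (begin
      ((oneMinusT ^S (n ℕ.+ 1)) ⊛ G) k  ≡⟨ oneMinusT^-⊛ (n ℕ.+ 1) G k ⟩
      Δ^ (n ℕ.+ 1) G k                  ≡⟨ cong (λ p → Δ^ p G k) (ℕₚ.+-comm n 1) ⟩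
      Δ^ (suc n) G k                    ≡⟨ Δ^-cong (suc n) e k ⟩
      Δ^ (suc n) (A ⊛ binomialSeries n) k ≡⟨ Δ^-binomialSeries n A k ⟩
      A k ∎)
    where open ≡-Reasoning

module Assembly where

  open import Data.Bool using (Bool; true; false; T)
  open import Data.Nat as ℕ using (ℕ; zero; suc; _∸_; _≤_; _<_; _≥_; s≤s; _≡ᵇ_; _<ᵇ_)
  open import Data.Nat.Properties
  open import Data.Nat.Combinatorics using (_C_; k>n⇒nCk≡0)
  open import Data.Integer as ℤ using (ℤ; +_)
  import Data.Integer.Properties as ℤₚ
  open import Data.List using (List; length; upTo)
  open import Data.List.Relation.Unary.All as All using (All)
  open import Data.Product using (_,_)
  open import Relation.Binary.PropositionalEquality
  open import Function using (_∘_)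
  open import Defs using (Series; sumTo; _⊛_; oneMinusT; _^S_; count; perms; b2n; gSeries)
  open Sums
  open Arrangements
  open Permutations using (range; range-length; range-increasing; perms-as-arrangements)
  open Labellings using (DescentRule; descents; labellings)
  open DescentFreeArrangements using (Comparative; descentFreeCount; descentFree-count)
  open Worpitzky using (gOnes; worpitzky)
  open QuasisymmetricAtOnes using (evalG-ones; gSum≡gOnes)
  open PowerSeries using (sumTo-shift; sumTo-cong; binomialSeries; divide-by-power)

  sumTo-as-ΣL : ∀ k (f : ℕ → ℕ) → sumTo k (λ i → + f i) ≡ + ∑[ i ← upTo (suc k) ] f i
  sumTo-as-ΣL zero    f = cong +_ (sym (+-identityʳ (f 0)))
  sumTo-as-ΣL (suc k) f = begin
      sumTo (suc k) (λ i → + f i)               ≡⟨ sumTo-shift k (λ i → + f i) ⟩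
      + f 0 ℤ.+ sumTo k (λ i → + f (suc i))     ≡⟨ cong (λ z → + f 0 ℤ.+ z) (sumTo-as-ΣL k (f ∘ suc)) ⟩
      + f 0 ℤ.+ + ∑[ i ← upTo (suc k) ] f (suc i) ≡⟨ sym (ℤₚ.pos-+ (f 0) _) ⟩
      + (f 0 ℕ.+ ∑[ i ← upTo (suc k) ] f (suc i)) ≡⟨ cong +_ (sym (ΣL-upTo-suc f (suc k))) ⟩
      + ∑[ i ← upTo (suc (suc k)) ] f i ∎
    where open ≡-Reasoning

  select : ∀ t j (h : ℕ → ℕ) → ∑[ i ← upTo (suc j) ] (b2n (t ≡ᵇ i) ℕ.* h i) ≡ b2n (t <ᵇ suc j) ℕ.* h t
  select zero    j       h = trans (ΣL-upTo-suc (λ i → b2n (0 ≡ᵇ i) ℕ.* h i) j)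
                                   (trans (cong (1 ℕ.* h 0 ℕ.+_) (ΣL-zero (λ _ → refl) (upTo j))) (+-identityʳ _))
  select (suc t) zero    h = refl
  select (suc t) (suc j) h = trans (ΣL-upTo-suc (λ i → b2n (suc t ≡ᵇ i) ℕ.* h i) (suc j)) (select t j (h ∘ suc))

  -- Σᵢ [s+1 = i] C(j-i+n, n) = C(j+n-1-s, n): the generating-function coefficient of
  -- t^{s+1}/(1-t)^{n+1} at t^j, for n ≥ 1.
  shifted-binomial : ∀ n s j → ∑[ i ← upTo (suc j) ] (b2n ((s ℕ.+ 1) ≡ᵇ i) ℕ.* ((j ∸ i ℕ.+ suc n) C suc n))
                               ≡ ((j ℕ.+ suc n) ∸ suc s) C suc n
  shifted-binomial n s j rewrite select (s ℕ.+ 1) j (λ i → (j ∸ i ℕ.+ suc n) C suc n) | +-comm s 1 with s <ᵇ j in s<ᵇj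
  ... | true  = trans (+-identityʳ _) (cong (_C suc n) (sym (+-∸-comm (suc n) (<ᵇ⇒< s j (subst T (sym s<ᵇj) _)))))
  ... | false = sym (k>n⇒nCk≡0 (s≤s (too-few (≮⇒≥ (λ s<j → subst T s<ᵇj (<⇒<ᵇ s<j))))))
    where
    too-few : j ≤ s → (j ℕ.+ suc n) ∸ suc s ≤ n
    too-few j≤s = begin
      (j ℕ.+ suc n) ∸ suc s ≡⟨ cong (_∸ suc s) (+-suc j n) ⟩
      (j ℕ.+ n) ∸ s         ≤⟨ ∸-monoˡ-≤ s (+-monoˡ-≤ n j≤s) ⟩
      (s ℕ.+ n) ∸ s         ≡⟨ m+n∸m≡n s n ⟩
      n ∎
      where open ≤-Reasoning

  module _ (rule : DescentRule) (comparative : Comparative rule)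
           (a : ℕ → ℕ) (a₀ : a 0 ≡ 1) (base : ∀ b g → descentFreeCount rule b (range g) g ≡ a g)
           (stat : List ℕ → ℕ) (stat-is-descents : ∀ w → stat w ≡ descents rule true w) where

    statPolynomial : ℕ → Series
    statPolynomial n k = + count (λ σ → (stat σ ℕ.+ 1) ≡ᵇ k) (perms n)

    coefficient-as-binomials : ∀ n j → (statPolynomial (suc n) ⊛ binomialSeries (suc n)) j
                                       ≡ + ∑[ σ ← perms (suc n) ] (((j ℕ.+ suc n) ∸ suc (stat σ)) C suc n)
    coefficient-as-binomials n j = begin
        sumTo j (λ i → + count (statIs i) (perms N) ℤ.* + c i)
          ≡⟨ trans (sumTo-cong j (λ i _ → sym (ℤₚ.pos-* (count (statIs i) (perms N)) (c i))))
                   (sumTo-as-ΣL j (λ i → count (statIs i) (perms N) ℕ.* c i)) ⟩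
        + ∑[ i ← upTo (suc j) ] (count (statIs i) (perms N) ℕ.* c i)
          ≡⟨ cong +_ (ΣL-ext (λ i → trans (cong (ℕ._* c i) (count-as-sum (statIs i) (perms N)))
                                         (sym (ΣL-*ʳ (c i) (b2n ∘ statIs i) (perms N))))
                             (upTo (suc j))) ⟩
        + ∑[ i ← upTo (suc j) ] ∑[ σ ← perms N ] (b2n (statIs i σ) ℕ.* c i)
          ≡⟨ cong +_ (ΣL-swap (λ i σ → b2n (statIs i σ) ℕ.* c i) (upTo (suc j)) (perms N)) ⟩
        + ∑[ σ ← perms N ] ∑[ i ← upTo (suc j) ] (b2n (statIs i σ) ℕ.* c i)
          ≡⟨ cong +_ (ΣL-ext (λ σ → shifted-binomial n (stat σ) j) (perms N)) ⟩
        + ∑[ σ ← perms N ] (((j ℕ.+ N) ∸ suc (stat σ)) C N) ∎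
      where
      open ≡-Reasoning
      N = suc n
      statIs : ℕ → List ℕ → Bool
      statIs i σ = (stat σ ℕ.+ 1) ≡ᵇ i
      c : ℕ → ℕ
      c i = (j ∸ i ℕ.+ N) C N

    binomials-as-gOnes : ∀ n j → ∑[ σ ← perms n ] (((j ℕ.+ n) ∸ suc (stat σ)) C n) ≡ gOnes a n j
    binomials-as-gOnes n j = begin
        ∑[ σ ← perms n ] (((j ℕ.+ n) ∸ suc (stat σ)) C n)
          ≡⟨ perms-as-arrangements n (λ σ → ((j ℕ.+ n) ∸ suc (stat σ)) C n) ⟩
        ∑[ α ← arrangements (range n) n ] (((j ℕ.+ n) ∸ suc (stat (word α))) C n)
          ≡⟨ ΣL-cong (All.map (λ {α} (ew , _) → as-labellings (word α) ew) (arrangements-length n (range n))) ⟩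
        ∑[ α ← arrangements (range n) n ] labellings rule true (word α) j
          ≡⟨ cong (λ k → ∑[ α ← arrangements (range n) k ] labellings rule true (word α) j) (sym (range-length n)) ⟩
        ∑[ α ← arrangements (range n) (length (range n)) ] labellings rule true (word α) j
          ≡⟨ worpitzky rule a (descentFree-count rule comparative a base) j true (range n) (range-increasing n) ⟩
        gOnes a (length (range n)) j
          ≡⟨ cong (λ k → gOnes a k j) (range-length n) ⟩
        gOnes a n j ∎
      where
      open ≡-Reasoning
      as-labellings : ∀ w → length w ≡ n → ((j ℕ.+ n) ∸ suc (stat w)) C n ≡ labellings rule true w j
      as-labellings w ew rewrite ew | stat-is-descents w = refl

    -- The coefficients of Σ_{m≥1} g_{f,n}(1^m) t^m, for n ≥ 1 (the t⁰ term is g_{f,n}(1⁰) = 0).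
    gSeries-coefficient : ∀ n j → gSeries a (suc n) j ≡ + gOnes a (suc n) j
    gSeries-coefficient n zero    = refl
    gSeries-coefficient n (suc j) = trans (evalG-ones a (suc n) (suc j)) (cong +_ (gSum≡gOnes a a₀ (suc j) (suc n)))

    generating-function : ∀ n → n ≥ 1 → (k : ℕ) → statPolynomial n k ≡ ((oneMinusT ^S (n ℕ.+ 1)) ⊛ gSeries a n) k
    generating-function (suc n) _ = divide-by-power (suc n) (statPolynomial (suc n)) (gSeries a (suc n))
      (λ j → trans (gSeries-coefficient n j)
                   (sym (trans (coefficient-as-binomials n j) (cong +_ (binomials-as-gOnes (suc n) j)))))

module ExponentialCase where

  open import Data.Bool using (Bool; true; false; not; T)
  open import Data.Empty using (⊥-elim)
  open import Data.Nat
  open import Data.Nat.Properties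
  open import Data.List using (List; []; _∷_; length)
  open import Data.List.Relation.Unary.All as All using (All; []; _∷_)
  open import Data.List.Relation.Unary.Any as Any using (Any; here; there)
  open import Data.List.Relation.Unary.AllPairs using (AllPairs; []; _∷_)
  open import Data.Product using (_,_; proj₂)
  open import Relation.Binary.PropositionalEquality
  open import Defs using (b2n; des; aExp; eulerianA; oneMinusT; _^S_; _⊛_; gSeries)
  open Sums
  open Arrangements
  open Permutations using (range; range-length; range-increasing)
  open Labellings using (DescentRule; descents; descentFree)
  open DescentFreeArrangements using (Comparative; descentFreeCount)
  open BooleanComparisons
  open Assembly using (generating-function)

  descentRule : DescentRule
  descentRule _ x y = y <ᵇ x

  comparative : Comparative descentRule
  comparative _ _ _ _ _ = proj₂

  des-as-descents : ∀ b w → des w ≡ descents descentRule b w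
  des-as-descents b []          = refl
  des-as-descents b (x ∷ [])    = refl
  des-as-descents b (x ∷ y ∷ r) = cong (b2n (y <ᵇ x) +_) (des-as-descents (not b) (y ∷ r))

  smaller-later : ∀ b x w → Any (_< x) w → descentFree descentRule b (x ∷ w) ≡ false
  smaller-later b x (y ∷ r) _ with y <ᵇ x in y<ᵇx
  ... | true = refl
  smaller-later b x (y ∷ r) (here y<x) | false = ⊥-elim (subst T y<ᵇx (<⇒<ᵇ y<x))
  smaller-later b x (y ∷ r) (there z∈) | false =
    smaller-later (not b) y r (Any.map (λ z<x → <-≤-trans z<x (≮⇒≥ (λ y<x → subst T y<ᵇx (<⇒<ᵇ y<x)))) z∈)

  smallest-first : ∀ b s w → All (s <_) w → descentFree descentRule b (s ∷ w) ≡ descentFree descentRule (not b) w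
  smallest-first b s []      _         = refl
  smallest-first b s (y ∷ r) (s<y ∷ _) rewrite <⇒>ᵇ-false s<y = refl

  increasing-unique : ∀ S → AllPairs _<_ S → ∀ b → descentFreeCount descentRule b S (length S) ≡ 1
  increasing-unique []      _          b = refl
  increasing-unique (s ∷ S) (s< ∷ inc) b = begin
      ∑[ α ← arrangements (s ∷ S) (suc k) ] df b (word α)
        ≡⟨ sum-arrangements-suc (λ α → df b (word α)) (s ∷ S) k ⟩
      ∑[ c ← choices (s ∷ S) ] ∑[ β ← arrangements (others c) k ] df b (chosen c ∷ word β)
        ≡⟨ sum-choices-∷ (λ c → ∑[ β ← arrangements (others c) k ] df b (chosen c ∷ word β)) s S ⟩
      ∑[ β ← arrangements S k ] df b (s ∷ word β)
        + ∑[ c ← choices S ] ∑[ β ← arrangements (s ∷ others c) k ] df b (chosen c ∷ word β)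
        ≡⟨ cong₂ _+_ smallest-chosen larger-chosen ⟩
      1 + 0 ∎
    where
    open ≡-Reasoning
    k = length S
    df : Bool → List ℕ → ℕ
    df b w = b2n (descentFree descentRule b w)
    smallest-chosen : ∑[ β ← arrangements S k ] df b (s ∷ word β) ≡ 1
    smallest-chosen = trans (ΣL-cong (All.map (λ {β} (s<w , _) → cong b2n (smallest-first b s (word β) s<w))
                                              (arrangements-All k S s<)))
                            (increasing-unique S inc (not b))
    larger-chosen : ∑[ c ← choices S ] ∑[ β ← arrangements (s ∷ others c) k ] df b (chosen c ∷ word β) ≡ 0
    larger-chosen = ΣL-zero-on (All.zipWith (λ {c} ((s<c , _) , ec) →
        ΣL-zero-on (All.map (λ {β} s∈ → cong b2n (smaller-later b (chosen c) (word β) s∈))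
                          (full-arrangements-Any k (s ∷ others c) ec (here s<c))))
      (choices-All S s< , choices-length S))

  base : ∀ b g → descentFreeCount descentRule b (range g) g ≡ aExp g
  base b g = trans (cong (descentFreeCount descentRule b (range g)) (sym (range-length g)))
                   (increasing-unique (range g) (range-increasing g) b)

  eulerian : ∀ n → n ≥ 1 → (k : ℕ) → eulerianA n k ≡ ((oneMinusT ^S (n + 1)) ⊛ gSeries aExp n) k
  eulerian = generating-function descentRule comparative aExp refl base des (des-as-descents true)

module TanSecCase where

  open import Data.Bool using (true; false; not; _∧_; T)
  open import Data.Empty using (⊥-elim)
  open import Data.Nat
  open import Data.Nat.Properties
  open import Data.List using ([]; _∷_; map; applyUpTo; applyDownFrom; reverse)
  open import Data.List.Properties using (map-applyUpTo; reverse-applyUpTo)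
  open import Data.List.Relation.Unary.All as All using (All; []; _∷_)
  open import Data.List.Relation.Unary.AllPairs using (AllPairs; []; _∷_)
  open import Data.List.Relation.Binary.Permutation.Propositional using (↭-reflexive; ↭-trans)
  open import Data.List.Relation.Binary.Permutation.Propositional.Properties using (↭-reverse)
  open import Data.Product using (_,_; proj₁; proj₂)
  open import Relation.Binary.PropositionalEquality
  open import Relation.Binary.Definitions using (tri<; tri≈; tri>)
  open import Function using (_∘_)
  open import Defs using (b2n; altDes; altDesAux; upDownAux; isUpDown; euler; perms; eulerianÂ; aTanSec; oneMinusT; _^S_; _⊛_; gSeries)
  open Sums
  open Arrangements
  open Permutations using (range; range-distinct; range-bounded; perms-as-arrangements)
  open Labellings using (DescentRule; descents; descentFree)
  open DescentFreeArrangements using (Comparative; descentFreeCount)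
  open BooleanComparisons
  open Assembly using (generating-function)

  altRule : DescentRule
  altRule true  x y = y <ᵇ x
  altRule false x y = x <ᵇ y

  comparative : Comparative altRule
  comparative true  _ _ _ _ = proj₂
  comparative false _ _ _ _ = proj₁

  altDes-as-descents : ∀ b w → altDesAux b w ≡ descents altRule b w
  altDes-as-descents true  []          = refl
  altDes-as-descents false []          = refl
  altDes-as-descents true  (x ∷ [])    = refl
  altDes-as-descents false (x ∷ [])    = refl
  altDes-as-descents true  (x ∷ y ∷ r) = cong (b2n (y <ᵇ x) +_) (altDes-as-descents false (y ∷ r))
  altDes-as-descents false (x ∷ y ∷ r) = cong (b2n (x <ᵇ y) +_) (altDes-as-descents true (y ∷ r))

  <ᵇ-flip : ∀ x y → x ≢ y → (x <ᵇ y) ≡ not (y <ᵇ x)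
  <ᵇ-flip x y x≢y with <-cmp x y
  ... | tri< x<y _ _ rewrite <⇒<ᵇ-true x<y | <⇒>ᵇ-false x<y = refl
  ... | tri≈ _ x≡y _ = ⊥-elim (x≢y x≡y)
  ... | tri> _ _ y<x rewrite <⇒<ᵇ-true y<x | <⇒>ᵇ-false y<x = refl

  upDown-as-descentFree : ∀ b w → AllPairs _≢_ w → upDownAux b w ≡ descentFree altRule b w
  upDown-as-descentFree true  []          _                = refl
  upDown-as-descentFree false []          _                = refl
  upDown-as-descentFree true  (x ∷ [])    _                = refl
  upDown-as-descentFree false (x ∷ [])    _                = refl
  upDown-as-descentFree true  (x ∷ y ∷ r) ((x≢y ∷ _) ∷ ds) =
    cong₂ _∧_ (<ᵇ-flip x y x≢y) (upDown-as-descentFree false (y ∷ r) ds)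
  upDown-as-descentFree false (x ∷ y ∷ r) ((x≢y ∷ _) ∷ ds) =
    cong₂ _∧_ (<ᵇ-flip y x (x≢y ∘ sym)) (upDown-as-descentFree true (y ∷ r) ds)

  up-down-count : ∀ g → descentFreeCount altRule true (range g) g ≡ euler g
  up-down-count g = sym (begin
      euler g
        ≡⟨ count-as-sum isUpDown (perms g) ⟩
      ∑[ σ ← perms g ] b2n (isUpDown σ)
        ≡⟨ perms-as-arrangements g (b2n ∘ isUpDown) ⟩
      ∑[ α ← arrangements (range g) g ] b2n (isUpDown (word α))
        ≡⟨ ΣL-cong (All.map (λ {α} (d , _) → cong b2n (upDown-as-descentFree true (word α) d))
                            (word-AllPairs (λ x≢y → x≢y ∘ sym) g (range g) (range-distinct g))) ⟩
      descentFreeCount altRule true (range g) g ∎)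
    where open ≡-Reasoning

  -- Complementation x ↦ g+1-x on [1..g] reverses comparisons, hence swaps the parities.
  module Complement (g : ℕ) where

    complement : ℕ → ℕ
    complement x = suc g ∸ x

    complement-<ᵇ : ∀ x y → x ≤ g → y ≤ g → (complement x <ᵇ complement y) ≡ (y <ᵇ x)
    complement-<ᵇ x y x≤g y≤g with y <ᵇ x in y<ᵇx
    ... | true  = <⇒<ᵇ-true (∸-monoʳ-< (<ᵇ⇒< y x (subst T (sym y<ᵇx) _)) (m≤n⇒m≤1+n x≤g))
    ... | false = ¬T⇒≡false (λ c<c → subst T y<ᵇx (<⇒<ᵇ (y<x (<ᵇ⇒< (complement x) (complement y) c<c))))
      where
      y<x : complement x < complement y → y < x
      y<x c<c = ≰⇒> (λ x≤y → <⇒≱ c<c (∸-monoʳ-≤ (suc g) x≤y))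

    complement-descentFree : ∀ b w → All (_≤ g) w →
      descentFree altRule b (map complement w) ≡ descentFree altRule (not b) w
    complement-descentFree b     []          _                 = refl
    complement-descentFree b     (x ∷ [])    _                 = refl
    complement-descentFree true  (x ∷ y ∷ r) (x≤g ∷ y≤g ∷ r≤g) =
      cong₂ (λ u v → not u ∧ v) (complement-<ᵇ y x y≤g x≤g) (complement-descentFree false (y ∷ r) (y≤g ∷ r≤g))
    complement-descentFree false (x ∷ y ∷ r) (x≤g ∷ y≤g ∷ r≤g) =
      cong₂ (λ u v → not u ∧ v) (complement-<ᵇ x y x≤g y≤g) (complement-descentFree true (y ∷ r) (y≤g ∷ r≤g))

    countdown : ∀ n → applyUpTo (n ∸_) n ≡ applyDownFrom suc n
    countdown zero    = refl
    countdown (suc n) = cong (suc n ∷_) (countdown n)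

    complement-range : map complement (range g) ≡ reverse (range g)
    complement-range = trans (map-applyUpTo suc complement g) (trans (countdown g) (sym (reverse-applyUpTo suc g)))

  down-up-count : ∀ g → descentFreeCount altRule false (range g) g ≡ euler g
  down-up-count g = begin
      descentFreeCount altRule false (range g) g
        ≡⟨ ΣL-cong (All.map (λ {α} (w≤g , _) → cong b2n (sym (complement-descentFree true (word α) w≤g)))
                            (arrangements-All g (range g) (range-bounded g))) ⟩
      ∑[ α ← arrangements (range g) g ] b2n (descentFree altRule true (map complement (word α)))
        ≡⟨ sym (arrangements-map complement g (λ α → b2n (descentFree altRule true (word α))) (range g)) ⟩
      descentFreeCount altRule true (map complement (range g)) g
        ≡⟨ arrangements-↭ g (b2n ∘ descentFree altRule true) (↭-trans (↭-reflexive complement-range) (↭-reverse (range g))) ⟩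
      descentFreeCount altRule true (range g) g
        ≡⟨ up-down-count g ⟩
      euler g ∎
    where
    open ≡-Reasoning
    open Complement g

  base : ∀ b g → descentFreeCount altRule b (range g) g ≡ euler g
  base true  = up-down-count
  base false = down-up-count

  alternating-eulerian : ∀ n → n ≥ 1 → (k : ℕ) → eulerianÂ n k ≡ ((oneMinusT ^S (n + 1)) ⊛ gSeries aTanSec n) k
  alternating-eulerian = generating-function altRule comparative euler refl base altDes (altDes-as-descents true)

open import Defs
open import Data.Nat using (ℕ; _≥_; _+_)
open import Data.Product using (_×_; _,_)
open import Relation.Binary.PropositionalEquality using (_≡_)

proposition5p2 : (n : ℕ) → n ≥ 1 →
    ((k : ℕ) → eulerianA n k ≡ ((oneMinusT ^S (n + 1)) ⊛ gSeries aExp n) k)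
    × ((k : ℕ) → eulerianÂ n k ≡ ((oneMinusT ^S (n + 1)) ⊛ gSeries aTanSec n) k)
proposition5p2 n n≥1 = ExponentialCase.eulerian n n≥1 , TanSecCase.alternating-eulerian n n≥1
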